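{- Let $G$ be a simple graph and let $(K,\mathsf m_K)$ be the core of the marked graph $(G,\mathbbm 1)$. Then $$X_G=D_{(K,\mathsf m_K)}(z_{w,0}=\mathfrak{st}_w,\ y=0),$$ i.e. $X_G$ is obtained from the $D$-polynomial of the core by substituting $z_{w,0}\mapsto\mathfrak{st}_w$ for every $w\ge1$ and $y\mapsto 0$.
   Context: $X_G=\sum_\kappa x_{\kappa(v_1)}\cdots x_{\kappa(v_n)}$ is the chromatic symmetric function of a simple graph $G$ with vertices $v_1,\dots,v_n$ (sum over proper colorings $\kappa:V(G)\to\{1,2,\dots\}$). $St_w$ is the star graph on $w$ vertices and $\mathfrak{st}_w=X_{St_w}$. Marks are pairs $(w,d)$ of integers with $w\ge1,d\ge0,w\ge d+1$, with dot-sum $(w,d)\dotplus(w',d')=(w+w',d+d'+1)$; a marked graph is a graph (loops and multiple edges allowed) with a mark on each vertex, and $(G,\mathbbm 1)$ gives every vertex the mark $(1,0)$. Contracting a non-loop edge $e=uv$ merges $u,v$ into a new vertex inheriting all other incident edges, with mark $\mathsf m(u)\dotplus\mathsf m(v)$. The $M$-polynomial in commuting indeterminates $y$, $z_{w,d}$: edgeless with marks $(w_i,d_i)$ gives $\prod z_{w_i,d_i}$; a loop $e$ gives $M_{(G,\mathsf m)}=y\,M_{(G\setminus e,\mathsf m)}$; a non-loop edge $e$ gives $M_{(G,\mathsf m)}=M_{(G\setminus e,\mathsf m)}+M_{(G/e,\mathsf m/e)}$. With $D_{\bullet_{w,d}}=\sum_{i=0}^d(-1)^i\binom di z_{w-i,0}z_{1,0}^i$,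 the $D$-polynomial is $M$ with each $z_{w,d}$ replaced by $D_{\bullet_{w,d}}$ (a polynomial in $y$ and the $z_{w,0}$). A vertex is absorbable if it has degree $1$ and mark $(1,0)$; an edge is absorbable if incident with an absorbable vertex. Absorbing an absorbable edge $e=uv$, $v$ absorbable, $\mathsf m(u)=(w,d)$, contracts $e$ and gives the resulting vertex mark $(w+1,d)$. The core is obtained by absorbing absorbable edges until none remain. -}

module Defs where

open import Level using (Level)
open import Algebra.Bundles using (CommutativeRing)
open import Data.Nat using (ℕ; zero; suc; _+_; _∸_; _≡ᵇ_; _<ᵇ_)
open import Data.Nat.Combinatorics using (_C_)
open import Data.Fin using (Fin; toℕ) renaming (zero to fzero; suc to fsuc)
open import Data.List using (List; []; _∷_; [_]; map; filter; concatMap; allFin; upTo; reverse; _++_; length; foldr)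
open import Data.Bool.ListAction using (and)
open import Data.Bool using (Bool; true; false; not; _∧_; _∨_; if_then_else_)
open import Data.Maybe using (Maybe; just; nothing)
open import Data.Product using (_×_; _,_; proj₁; proj₂)
open import Data.Vec.Functional using (Vector) renaming (_∷_ to _◂_)
open import Relation.Binary.PropositionalEquality using (_≡_; refl)
open import Relation.Nullary.Decidable using (⌊_⌋)
import Data.Nat as ℕ

record SimpleGraph (n : ℕ) : Set where
  field
    adj        : Fin n → Fin n → Bool
    adj-sym    : ∀ i j → adj i j ≡ adj j i
    adj-irrefl : ∀ i → adj i i ≡ false
open SimpleGraph public

starAdj : ∀ {w} → Fin w → Fin w → Bool
starAdj fzero    fzero    = false
starAdj fzero    (fsuc _) = true
starAdj (fsuc _) fzero    = true
starAdj (fsuc _) (fsuc _) = false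

Star : (w : ℕ) → SimpleGraph w
Star w = record { adj = starAdj ; adj-sym = sym' ; adj-irrefl = irr }
  where
  sym' : ∀ (i j : Fin w) → starAdj i j ≡ starAdj j i
  sym' fzero    fzero    = refl
  sym' fzero    (fsuc _) = refl
  sym' (fsuc _) fzero    = refl
  sym' (fsuc _) (fsuc _) = refl
  irr : ∀ (i : Fin w) → starAdj i i ≡ false
  irr fzero    = refl
  irr (fsuc _) = refl

-- Colourings with colours {1..N} (represented by Fin N)

allColourings : (n N : ℕ) → List (Fin n → Fin N)
allColourings zero    N = [ (λ ()) ]
allColourings (suc n) N =
  concatMap (λ c → map (λ f → c ◂ f) (allColourings n N)) (allFin N)

properᵇ : ∀ {n N} → SimpleGraph n → (Fin n → Fin N) → Bool
properᵇ {n} G κ =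
  and (concatMap (λ i → map (λ j → not (adj G i j ∧ (toℕ (κ i) ≡ᵇ toℕ (κ j))))
                            (allFin n))
                 (allFin n))

module _ {c ℓ : Level} (R : CommutativeRing c ℓ) where
  open CommutativeRing R using (Carrier; 0#; 1#; -_) renaming (_+_ to _+R_; _*_ to _*R_)

  sumR : List Carrier → Carrier
  sumR = foldr _+R_ 0#

  prodR : List Carrier → Carrier
  prodR = foldr _*R_ 1#

  fromℕR : ℕ → Carrier
  fromℕR zero    = 0#
  fromℕR (suc k) = 1# +R fromℕR k

  powR : Carrier → ℕ → Carrier
  powR a zero    = 1#
  powR a (suc k) = a *R powR a k

  signR : ℕ → Carrier → Carrier
  signR zero          a = a
  signR (suc zero)    a = - a
  signR (suc (suc k)) a = signR k a

  -- Chromatic symmetric function X_G evaluated at (x_1,…,x_N) = x :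
  --   sum over proper κ : V → {1..N} of ∏_v x_{κ(v)}
  X : ∀ {n N} → SimpleGraph n → (Fin N → Carrier) → Carrier
  X {n} {N} G x =
    sumR (map (λ κ → prodR (map (λ v → x (κ v)) (allFin n)))
              (filter (λ κ → properᵇ G κ ≟b true) (allColourings n N)))
    where
    open import Data.Bool.Properties using () renaming (_≟_ to _≟b_)

-- Marked (multi)graphs.  Vertices carry natural-number labels; loops and
-- parallel edges are allowed (an edge is an ordered pair of labels, a loop
-- is a pair (u , u)).

Mark : Set
Mark = ℕ × ℕ

_∔_ : Mark → Mark → Mark
(w , d) ∔ (w' , d') = (w + w' , d + d' + 1)

Edge : Set
Edge = ℕ × ℕ

record MGraph : Set where
  constructor mgraph
  field
    verts : List (ℕ × Mark)
    edges : List Edge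
open MGraph public

markOf : ℕ → List (ℕ × Mark) → Mark
markOf u []              = (1 , 0)
markOf u ((v , m) ∷ vs)  = if u ≡ᵇ v then m else markOf u vs

setMark : ℕ → Mark → List (ℕ × Mark) → List (ℕ × Mark)
setMark u m []             = []
setMark u m ((v , m') ∷ vs) = (if u ≡ᵇ v then (v , m) else (v , m')) ∷ setMark u m vs

removeV : ℕ → List (ℕ × Mark) → List (ℕ × Mark)
removeV u []              = []
removeV u ((v , m) ∷ vs)  = if u ≡ᵇ v then removeV u vs else (v , m) ∷ removeV u vs

renameE : ℕ → ℕ → List Edge → List Edge
renameE v u = map (λ { (a , b) → (r a , r b) })
  where
  r : ℕ → ℕ
  r a = if a ≡ᵇ v then u else a

contractVerts : ℕ → ℕ → List (ℕ × Mark) → List (ℕ × Mark)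
contractVerts u v vs = setMark u (markOf u vs ∔ markOf v vs) (removeV v vs)

-- M-polynomial, evaluated in a commutative ring at y and z_{w,d} = z (w , d).
-- Deletion–contraction on the first edge of the edge list; the fuel argument
-- (initially the number of edges) decreases with the number of edges.

module _ {c ℓ : Level} (R : CommutativeRing c ℓ) where
  open CommutativeRing R using (Carrier; 0#; 1#; -_) renaming (_+_ to _+R_; _*_ to _*R_)

  Mfuel : ℕ → Carrier → (Mark → Carrier) → List (ℕ × Mark) → List Edge → Carrier
  Mfuel zero    y z vs es = prodR R (map (λ p → z (proj₂ p)) vs)
  Mfuel (suc f) y z vs []  = prodR R (map (λ p → z (proj₂ p)) vs)
  Mfuel (suc f) y z vs ((u , v) ∷ es) =
    if u ≡ᵇ v
      then y *R Mfuel f y z vs es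
      else (Mfuel f y z vs es +R Mfuel f y z (contractVerts u v vs) (renameE v u es))

  M : Carrier → (Mark → Carrier) → MGraph → Carrier
  M y z G = Mfuel (length (edges G)) y z (verts G) (edges G)

  Dbullet : (ℕ → Carrier) → Mark → Carrier
  Dbullet z0 (w , d) =
    sumR R (map (λ i → signR R i (fromℕR R (d C i) *R (z0 (w ∸ i) *R powR R (z0 1) i)))
                (upTo (suc d)))

  D : Carrier → (ℕ → Carrier) → MGraph → Carrier
  D y z0 G = M y (Dbullet z0) G

edgeList : ∀ {n} → SimpleGraph n → List Edge
edgeList {n} G =
  concatMap (λ i → map (λ j → (toℕ i , toℕ j))
                       (filter (λ j → ((toℕ i <ᵇ toℕ j) ∧ adj G i j) ≟b true) (allFin n)))
            (allFin n)
  where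
  open import Data.Bool.Properties using () renaming (_≟_ to _≟b_)

marked𝟙 : ∀ {n} → SimpleGraph n → MGraph
marked𝟙 {n} G = mgraph (map (λ i → (toℕ i , (1 , 0))) (allFin n)) (edgeList G)

degree : ℕ → List Edge → ℕ
degree v []              = 0
degree v ((a , b) ∷ es)  =
  (if a ≡ᵇ v then 1 else 0) + (if b ≡ᵇ v then 1 else 0) + degree v es

absorbableV : MGraph → ℕ → Bool
absorbableV G v =
  (degree v (edges G) ≡ᵇ 1) ∧ (proj₁ (markOf v (verts G)) ≡ᵇ 1)
                            ∧ (proj₂ (markOf v (verts G)) ≡ᵇ 0)

pickAbs : MGraph → List Edge → List Edge → Maybe (ℕ × ℕ × List Edge)
pickAbs G acc []             = nothing
pickAbs G acc ((a , b) ∷ es) =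
  if absorbableV G b then just (a , b , reverse acc ++ es)
  else if absorbableV G a then just (b , a , reverse acc ++ es)
  else pickAbs G ((a , b) ∷ acc) es

absorbStep : MGraph → Maybe MGraph
absorbStep G with pickAbs G [] (edges G)
... | nothing            = nothing
... | just (u , v , es)  =
  just (mgraph (setMark u (suc (proj₁ (markOf u (verts G))) , proj₂ (markOf u (verts G)))
                          (removeV v (verts G)))
               es)

coreFuel : ℕ → MGraph → MGraph
coreFuel zero    G = G
coreFuel (suc f) G with absorbStep G
... | nothing = G
... | just G' = coreFuel f G'

core : MGraph → MGraph
core G = coreFuel (length (edges G)) G

{-# OPTIONS --safe #-}
-- Fix N colours, put p₁ = x₁ + ⋯ + x_N, and give a vertex of mark (w , d) coloured c the weight
-- (−1)^d x_c^(d+1) (p₁ − x_c)^(w−d−1). The state sum of a marked graph sums, over all colourings of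
-- its vertices, the product of the vertex weights and of the indicators [κ(u) ≠ κ(v)] of its edges uv;
-- for (G , 𝟙) it is X_G. Absorbing a leaf does not change it: summing out the colour of the leaf
-- multiplies the weight of its neighbour by p₁ − x_c, which turns the mark (w , d) into (w + 1 , d).
-- The state sum obeys the recurrence of M at y = 0: a loop is never properly coloured,
-- [κ(u) ≠ κ(v)] = 1 − [κ(u) = κ(v)], and forcing κ(u) = κ(v) fuses the two weights into minus the
-- weight of m(u) ∔ m(v). On an edgeless graph it is the product of the sums Σ_c weight(m)(c), and as
-- st_(k+1) = Σ_c x_c (p₁ − x_c)^k, the binomial theorem identifies these with D_•(w,d) at z_(w,0) = st_w.

module Submission where

open import Defs
open import Level using (Level)
open import Algebra.Bundles using (CommutativeRing)
open import Data.Nat using (ℕ; zero; suc; _≡ᵇ_; _<ᵇ_)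
import Data.Nat as ℕ
import Data.Nat.Properties as ℕP
open import Data.Nat.Combinatorics using (_C_; nCk+nC[k+1]≡[n+1]C[k+1]; k>n⇒nCk≡0)
open import Data.Fin using (Fin; toℕ) renaming (zero to fzero; suc to fsuc)
import Data.Fin.Properties as FP
open import Data.Bool using (Bool; true; false; not; _∧_; _∨_; if_then_else_; T)
import Data.Bool.Properties as BP
open import Data.Bool.ListAction using (and)
open import Data.Product using (_×_; _,_; proj₁; proj₂; Σ)
open import Data.Sum using (_⊎_; inj₁; inj₂)
open import Data.Empty using (⊥-elim)
open import Data.Unit using (tt)
open import Data.Maybe using (just; nothing)
open import Relation.Binary.PropositionalEquality as ≡ using (_≡_; _≢_; refl; cong; cong₂; subst)
open import Data.List using (List; []; _∷_; [_]; map; tabulate; allFin; _++_; concatMap; length; reverse; filter; upTo)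
import Data.List.Properties as LP
open import Data.List.Relation.Unary.All using (All; []; _∷_)
import Data.List.Relation.Unary.All as All
import Data.List.Relation.Unary.All.Properties as All
open import Data.List.Relation.Unary.Any using (here; there)
open import Data.List.Membership.Propositional using (_∈_)
open import Data.List.Membership.Propositional.Properties using (∈-map⁺; ∈-map⁻; ∈-concat⁺′; ∈-concat⁻′; ∈-filter⁺; ∈-filter⁻; ∈-allFin)
open import Relation.Binary.Definitions using (tri<; tri≈; tri>)
open import Relation.Nullary using (yes; no)
open import Data.Vec.Functional using () renaming (_∷_ to _◂_)
open import Function using (_∘_; id)
open import Function.Bundles using (Equivalence)
open import Data.Nat.Tactic.RingSolver using (solve-∀)

≡ᵇ-refl : ∀ n → (n ≡ᵇ n) ≡ true
≡ᵇ-refl zero    = refl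
≡ᵇ-refl (suc n) = ≡ᵇ-refl n

≡ᵇ-sym : ∀ m n → (m ≡ᵇ n) ≡ (n ≡ᵇ m)
≡ᵇ-sym zero    zero    = refl
≡ᵇ-sym zero    (suc n) = refl
≡ᵇ-sym (suc m) zero    = refl
≡ᵇ-sym (suc m) (suc n) = ≡ᵇ-sym m n

≡ᵇ-true⇒≡ : ∀ m n → (m ≡ᵇ n) ≡ true → m ≡ n
≡ᵇ-true⇒≡ m n e = ℕP.≡ᵇ⇒≡ m n (subst T (≡.sym e) tt)

≢⇒≡ᵇ-false : ∀ {m n} → m ≢ n → (m ≡ᵇ n) ≡ false
≢⇒≡ᵇ-false {m} {n} m≢n with m ≡ᵇ n in e
... | true  = ⊥-elim (m≢n (≡ᵇ-true⇒≡ m n e))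
... | false = refl

∨-false⁻ : ∀ {a b : Bool} → (a ∨ b) ≡ false → (a ≡ false) × (b ≡ false)
∨-false⁻ {false} {false} _ = refl , refl

∧-true⁻ : ∀ {a b : Bool} → (a ∧ b) ≡ true → (a ≡ true) × (b ≡ true)
∧-true⁻ {true} {true} _ = refl , refl

occurs : ℕ → List (ℕ × Mark) → Bool
occurs a []             = false
occurs a ((v , _) ∷ vs) = (a ≡ᵇ v) ∨ occurs a vs

data Distinct : List (ℕ × Mark) → Set where
  []  : Distinct []
  _∷_ : ∀ {v m vs} → occurs v vs ≡ false → Distinct vs → Distinct ((v , m) ∷ vs)

occurs-setMark : ∀ a u M vs → occurs a (setMark u M vs) ≡ occurs a vs
occurs-setMark a u M []             = refl
occurs-setMark a u M ((v , m) ∷ vs) with u ≡ᵇ v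
... | true  = cong ((a ≡ᵇ v) ∨_) (occurs-setMark a u M vs)
... | false = cong ((a ≡ᵇ v) ∨_) (occurs-setMark a u M vs)

occurs-removeV : ∀ {a u} vs → (a ≡ᵇ u) ≡ false → occurs a (removeV u vs) ≡ occurs a vs
occurs-removeV []             a≢u = refl
occurs-removeV {a} {u} ((v , m) ∷ vs) a≢u with u ≡ᵇ v in u≡v
... | true with refl ← ≡ᵇ-true⇒≡ u v u≡v rewrite a≢u = occurs-removeV vs a≢u
... | false = cong ((a ≡ᵇ v) ∨_) (occurs-removeV vs a≢u)

occurs-removeV-false : ∀ {a} u vs → occurs a vs ≡ false → occurs a (removeV u vs) ≡ false
occurs-removeV-false u []             _ = refl
occurs-removeV-false {a} u ((v , m) ∷ vs) a∉ with ∨-false⁻ {a ≡ᵇ v} a∉ | u ≡ᵇ v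
... | _   , a∉vs | true  = occurs-removeV-false u vs a∉vs
... | a≢v , a∉vs | false rewrite a≢v = occurs-removeV-false u vs a∉vs

Distinct-removeV : ∀ u {vs} → Distinct vs → Distinct (removeV u vs)
Distinct-removeV u []                     = []
Distinct-removeV u {(v , m) ∷ vs} (v∉ ∷ d) with u ≡ᵇ v
... | true  = Distinct-removeV u d
... | false = occurs-removeV-false u vs v∉ ∷ Distinct-removeV u d

Distinct-setMark : ∀ u M {vs} → Distinct vs → Distinct (setMark u M vs)
Distinct-setMark u M []                     = []
Distinct-setMark u M {(v , m) ∷ vs} (v∉ ∷ d) with u ≡ᵇ v
... | true  = ≡.trans (occurs-setMark v u M vs) v∉ ∷ Distinct-setMark u M d
... | false = ≡.trans (occurs-setMark v u M vs) v∉ ∷ Distinct-setMark u M d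

removeV-absent : ∀ u vs → occurs u vs ≡ false → removeV u vs ≡ vs
removeV-absent u []             _  = refl
removeV-absent u ((v , m) ∷ vs) u∉ with ∨-false⁻ {u ≡ᵇ v} u∉
... | u≢v , u∉vs rewrite u≢v = cong ((v , m) ∷_) (removeV-absent u vs u∉vs)

removeV-comm : ∀ u v vs → removeV u (removeV v vs) ≡ removeV v (removeV u vs)
removeV-comm u v []             = refl
removeV-comm u v ((w , m) ∷ vs) with v ≡ᵇ w in v≡w | u ≡ᵇ w in u≡w
... | true  | true  = removeV-comm u v vs
... | true  | false rewrite v≡w = removeV-comm u v vs
... | false | true  rewrite u≡w = removeV-comm u v vs
... | false | false rewrite v≡w | u≡w = cong ((w , m) ∷_) (removeV-comm u v vs)

removeV-setMark : ∀ u M vs → removeV u (setMark u M vs) ≡ removeV u vs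
removeV-setMark u M []             = refl
removeV-setMark u M ((v , m) ∷ vs) with u ≡ᵇ v in u≡v
... | true  rewrite u≡v = removeV-setMark u M vs
... | false rewrite u≡v = cong ((v , m) ∷_) (removeV-setMark u M vs)

markOf-removeV : ∀ {u v} vs → (u ≡ᵇ v) ≡ false → markOf u (removeV v vs) ≡ markOf u vs
markOf-removeV []             u≢v = refl
markOf-removeV {u} {v} ((w , m) ∷ vs) u≢v with v ≡ᵇ w in v≡w
... | true with refl ← ≡ᵇ-true⇒≡ v w v≡w rewrite u≢v = markOf-removeV vs u≢v
... | false with u ≡ᵇ w
...   | true  = refl
...   | false = markOf-removeV vs u≢v

markOf-setMark : ∀ u M vs → occurs u vs ≡ true → markOf u (setMark u M vs) ≡ M
markOf-setMark u M ((v , m) ∷ vs) u∈ with u ≡ᵇ v in u≡v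
... | true  rewrite u≡v = refl
... | false rewrite u≡v = markOf-setMark u M vs u∈

module RingSums {c ℓ : Level} (R : CommutativeRing c ℓ) where
  open CommutativeRing R renaming (refl to ≈-refl)
  open import Relation.Binary.Reasoning.Setoid setoid
  open import Algebra.Properties.Ring ring
    using (-‿distribˡ-*; -‿distribʳ-*; -‿involutive; -0#≈0#; -‿+-comm) public
  open import Algebra.Properties.CommutativeSemigroup *-commutativeSemigroup
    using () renaming (x∙yz≈y∙xz to x*yz≈y*xz) public

  ∑ : ∀ {A : Set} → List A → (A → Carrier) → Carrier
  ∑ L f = sumR R (map f L)

  ∑-cong : ∀ {A : Set} (L : List A) {f g : A → Carrier} → (∀ a → f a ≈ g a) → ∑ L f ≈ ∑ L g
  ∑-cong []      f≈g = ≈-refl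
  ∑-cong (a ∷ L) f≈g = +-cong (f≈g a) (∑-cong L f≈g)

  ∑-zero : ∀ {A : Set} (L : List A) {f : A → Carrier} → (∀ a → f a ≈ 0#) → ∑ L f ≈ 0#
  ∑-zero []      f≈0 = ≈-refl
  ∑-zero (a ∷ L) f≈0 = trans (+-cong (f≈0 a) (∑-zero L f≈0)) (+-identityˡ 0#)

  ∑-+ : ∀ {A : Set} (L : List A) (f g : A → Carrier) → ∑ L (λ a → f a + g a) ≈ ∑ L f + ∑ L g
  ∑-+ []      f g = sym (+-identityˡ 0#)
  ∑-+ (a ∷ L) f g = begin
    (f a + g a) + ∑ L (λ a → f a + g a) ≈⟨ +-congˡ (∑-+ L f g) ⟩
    (f a + g a) + (∑ L f + ∑ L g)       ≈⟨ +-assoc (f a) (g a) _ ⟩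
    f a + (g a + (∑ L f + ∑ L g))       ≈⟨ +-congˡ (sym (+-assoc (g a) _ _)) ⟩
    f a + ((g a + ∑ L f) + ∑ L g)       ≈⟨ +-congˡ (+-congʳ (+-comm (g a) _)) ⟩
    f a + ((∑ L f + g a) + ∑ L g)       ≈⟨ +-congˡ (+-assoc _ (g a) _) ⟩
    f a + (∑ L f + (g a + ∑ L g))       ≈⟨ sym (+-assoc (f a) _ _) ⟩
    (f a + ∑ L f) + (g a + ∑ L g)       ∎

  ∑-neg : ∀ {A : Set} (L : List A) (f : A → Carrier) → ∑ L (λ a → - f a) ≈ - ∑ L f
  ∑-neg []      f = sym -0#≈0#
  ∑-neg (a ∷ L) f = trans (+-congˡ (∑-neg L f)) (-‿+-comm (f a) _)

  ∑-*ˡ : ∀ {A : Set} (L : List A) (s : Carrier) (f : A → Carrier) → ∑ L (λ a → s * f a) ≈ s * ∑ L f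
  ∑-*ˡ []      s f = sym (zeroʳ s)
  ∑-*ˡ (a ∷ L) s f = trans (+-congˡ (∑-*ˡ L s f)) (sym (distribˡ s (f a) _))

  ∑-*ʳ : ∀ {A : Set} (L : List A) (s : Carrier) (f : A → Carrier) → ∑ L (λ a → f a * s) ≈ ∑ L f * s
  ∑-*ʳ L s f = begin
    ∑ L (λ a → f a * s) ≈⟨ ∑-cong L (λ a → *-comm (f a) s) ⟩
    ∑ L (λ a → s * f a) ≈⟨ ∑-*ˡ L s f ⟩
    s * ∑ L f           ≈⟨ *-comm s _ ⟩
    ∑ L f * s           ∎

  ∑-swap : ∀ {A B : Set} (L₁ : List A) (L₂ : List B) (f : A → B → Carrier) →
           ∑ L₁ (λ a → ∑ L₂ (f a)) ≈ ∑ L₂ (λ b → ∑ L₁ (λ a → f a b))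
  ∑-swap []       L₂ f = sym (∑-zero L₂ (λ _ → ≈-refl))
  ∑-swap (a ∷ L₁) L₂ f =
    trans (+-congˡ (∑-swap L₁ L₂ f)) (sym (∑-+ L₂ (f a) _))

  ∑-++ : ∀ {A : Set} (L₁ L₂ : List A) (f : A → Carrier) → ∑ (L₁ ++ L₂) f ≈ ∑ L₁ f + ∑ L₂ f
  ∑-++ []       L₂ f = sym (+-identityˡ _)
  ∑-++ (a ∷ L₁) L₂ f = trans (+-congˡ (∑-++ L₁ L₂ f)) (sym (+-assoc _ _ _))

  ∑-concatMap : ∀ {A B : Set} (L : List A) (g : A → List B) (f : B → Carrier) →
                ∑ (concatMap g L) f ≈ ∑ L (λ a → ∑ (g a) f)
  ∑-concatMap []      g f = ≈-refl
  ∑-concatMap (a ∷ L) g f = trans (∑-++ (g a) (concatMap g L) f) (+-congˡ (∑-concatMap L g f))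

  ∑-map : ∀ {A B : Set} (L : List A) (h : A → B) (f : B → Carrier) → ∑ (map h L) f ≡ ∑ L (f ∘ h)
  ∑-map L h f = cong (sumR R) (≡.sym (LP.map-∘ L))

  ∑-allFin-suc : ∀ n (f : Fin (suc n) → Carrier) →
                 ∑ (allFin (suc n)) f ≈ f fzero + ∑ (allFin n) (f ∘ fsuc)
  ∑-allFin-suc n f = +-congˡ (reflexive (cong (sumR R)
    (≡.trans (LP.map-tabulate fsuc f) (≡.sym (LP.map-tabulate id (f ∘ fsuc))))))

  ∑-upTo-suc : ∀ n (f : ℕ → Carrier) → ∑ (upTo (suc n)) f ≈ f 0 + ∑ (upTo n) (f ∘ suc)
  ∑-upTo-suc n f = +-congˡ (reflexive (cong (sumR R)
    (≡.trans (LP.map-applyUpTo suc f n) (≡.sym (LP.map-applyUpTo id (f ∘ suc) n)))))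

  ∑-upTo-last : ∀ n (f : ℕ → Carrier) → ∑ (upTo (suc n)) f ≈ ∑ (upTo n) f + f n
  ∑-upTo-last zero    f = +-comm _ _
  ∑-upTo-last (suc n) f = begin
    ∑ (upTo (suc (suc n))) f                ≈⟨ ∑-upTo-suc (suc n) f ⟩
    f 0 + ∑ (upTo (suc n)) (f ∘ suc)        ≈⟨ +-congˡ (∑-upTo-last n (f ∘ suc)) ⟩
    f 0 + (∑ (upTo n) (f ∘ suc) + f (suc n)) ≈⟨ sym (+-assoc _ _ _) ⟩
    (f 0 + ∑ (upTo n) (f ∘ suc)) + f (suc n) ≈⟨ +-congʳ (sym (∑-upTo-suc n f)) ⟩
    ∑ (upTo (suc n)) f + f (suc n)           ∎

  ∑-upTo-cong : ∀ n {f g : ℕ → Carrier} → (∀ i → i ℕ.< n → f i ≈ g i) → ∑ (upTo n) f ≈ ∑ (upTo n) g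
  ∑-upTo-cong zero    f≈g = ≈-refl
  ∑-upTo-cong (suc n) {f} {g} f≈g = begin
    ∑ (upTo (suc n)) f                ≈⟨ ∑-upTo-suc n f ⟩
    f 0 + ∑ (upTo n) (f ∘ suc)        ≈⟨ +-cong (f≈g 0 (ℕ.s≤s ℕ.z≤n)) (∑-upTo-cong n (λ i i<n → f≈g (suc i) (ℕ.s≤s i<n))) ⟩
    g 0 + ∑ (upTo n) (g ∘ suc)        ≈⟨ sym (∑-upTo-suc n g) ⟩
    ∑ (upTo (suc n)) g                ∎

  fromBool : Bool → Carrier
  fromBool b = if b then 1# else 0#

  ∑-filter : ∀ {A : Set} (L : List A) (p : A → Bool) (f : A → Carrier) →
             ∑ (filter (λ a → p a BP.≟ true) L) f ≈ ∑ L (λ a → f a * fromBool (p a))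
  ∑-filter []      p f = ≈-refl
  ∑-filter (a ∷ L) p f with p a
  ... | true  = +-cong (sym (*-identityʳ _)) (∑-filter L p f)
  ... | false = trans (∑-filter L p f) (sym (trans (+-congʳ (zeroʳ _)) (+-identityˡ _)))

  δ : ℕ → ℕ → Carrier
  δ a b = if a ≡ᵇ b then 1# else 0#

  δᶜ : ℕ → ℕ → Carrier
  δᶜ a b = if a ≡ᵇ b then 0# else 1#

  δ-sym : ∀ a b → δ a b ≡ δ b a
  δ-sym a b = cong (if_then 1# else 0#) (≡ᵇ-sym a b)

  δᶜ-sym : ∀ a b → δᶜ a b ≡ δᶜ b a
  δᶜ-sym a b = cong (if_then 0# else 1#) (≡ᵇ-sym a b)

  δᶜ-refl : ∀ a → δᶜ a a ≡ 0#
  δᶜ-refl a rewrite ≡ᵇ-refl a = refl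

  δᶜ-*≈-δ-* : ∀ a b q → δᶜ a b * q ≈ q + - (δ a b * q)
  δᶜ-*≈-δ-* a b q with a ≡ᵇ b
  ... | true  = trans (zeroˡ q) (sym (trans (+-congˡ (-‿cong (*-identityˡ q))) (-‿inverseʳ q)))
  ... | false = trans (*-identityˡ q) (sym (trans (+-congˡ (trans (-‿cong (zeroˡ q)) -0#≈0#)) (+-identityʳ q)))

  ∑-δ : ∀ n (k : Fin n) (f : Fin n → Carrier) → ∑ (allFin n) (λ c → δ (toℕ c) (toℕ k) * f c) ≈ f k
  ∑-δ (suc n) fzero f = begin
    ∑ (allFin (suc n)) (λ c → δ (toℕ c) 0 * f c)          ≈⟨ ∑-allFin-suc n _ ⟩
    1# * f fzero + ∑ (allFin n) (λ i → 0# * f (fsuc i)) ≈⟨ +-cong (*-identityˡ _) (∑-zero (allFin n) (λ i → zeroˡ _)) ⟩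
    f fzero + 0#                                         ≈⟨ +-identityʳ _ ⟩
    f fzero                                              ∎
  ∑-δ (suc n) (fsuc k) f = begin
    ∑ (allFin (suc n)) (λ c → δ (toℕ c) (suc (toℕ k)) * f c)           ≈⟨ ∑-allFin-suc n _ ⟩
    0# * f fzero + ∑ (allFin n) (λ i → δ (toℕ i) (toℕ k) * f (fsuc i)) ≈⟨ +-cong (zeroˡ _) (∑-δ n k (f ∘ fsuc)) ⟩
    0# + f (fsuc k)                                                    ≈⟨ +-identityˡ _ ⟩
    f (fsuc k)                                                         ∎

  signR-suc : ∀ k a → signR R (suc k) a ≈ - signR R k a
  signR-suc zero    a = ≈-refl
  signR-suc (suc k) a = sym (trans (-‿cong (signR-suc k a)) (-‿involutive _))

  signR-cong : ∀ k {a b} → a ≈ b → signR R k a ≈ signR R k b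
  signR-cong zero          a≈b = a≈b
  signR-cong (suc zero)    a≈b = -‿cong a≈b
  signR-cong (suc (suc k)) a≈b = signR-cong k a≈b

  signR-*ʳ : ∀ k a b → signR R k (a * b) ≈ signR R k a * b
  signR-*ʳ zero          a b = ≈-refl
  signR-*ʳ (suc zero)    a b = -‿distribˡ-* a b
  signR-*ʳ (suc (suc k)) a b = signR-*ʳ k a b

  signR-*ˡ : ∀ k a b → signR R k (a * b) ≈ a * signR R k b
  signR-*ˡ zero          a b = ≈-refl
  signR-*ˡ (suc zero)    a b = -‿distribʳ-* a b
  signR-*ˡ (suc (suc k)) a b = signR-*ˡ k a b

  signR≈sign1* : ∀ k a → signR R k a ≈ signR R k 1# * a
  signR≈sign1* k a = trans (signR-cong k (sym (*-identityˡ a))) (signR-*ʳ k 1# a)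

  signR-+ : ∀ m n a b → signR R (m ℕ.+ n) (a * b) ≈ signR R m a * signR R n b
  signR-+ zero    n a b = signR-*ˡ n a b
  signR-+ (suc m) n a b = begin
    signR R (suc (m ℕ.+ n)) (a * b)  ≈⟨ signR-suc (m ℕ.+ n) _ ⟩
    - signR R (m ℕ.+ n) (a * b)      ≈⟨ -‿cong (signR-+ m n a b) ⟩
    - (signR R m a * signR R n b)    ≈⟨ -‿distribˡ-* _ _ ⟩
    (- signR R m a) * signR R n b    ≈⟨ *-congʳ (sym (signR-suc m a)) ⟩
    signR R (suc m) a * signR R n b  ∎

  powR-cong : ∀ k {a b} → a ≈ b → powR R a k ≈ powR R b k
  powR-cong zero    a≈b = ≈-refl
  powR-cong (suc k) a≈b = *-cong a≈b (powR-cong k a≈b)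

  powR-+ : ∀ a m n → powR R a (m ℕ.+ n) ≈ powR R a m * powR R a n
  powR-+ a zero    n = sym (*-identityˡ _)
  powR-+ a (suc m) n = trans (*-congˡ (powR-+ a m n)) (sym (*-assoc _ _ _))

  powR-neg : ∀ a d → powR R (- a) d ≈ signR R d (powR R a d)
  powR-neg a zero    = ≈-refl
  powR-neg a (suc d) = begin
    (- a) * powR R (- a) d           ≈⟨ *-congˡ (powR-neg a d) ⟩
    (- a) * signR R d (powR R a d)   ≈⟨ sym (-‿distribˡ-* _ _) ⟩
    - (a * signR R d (powR R a d))   ≈⟨ -‿cong (sym (signR-*ˡ d a _)) ⟩
    - signR R d (a * powR R a d)     ≈⟨ sym (signR-suc d _) ⟩
    signR R (suc d) (powR R a (suc d)) ∎

  fromℕR-+ : ∀ m n → fromℕR R (m ℕ.+ n) ≈ fromℕR R m + fromℕR R n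
  fromℕR-+ zero    n = sym (+-identityˡ _)
  fromℕR-+ (suc m) n = trans (+-congˡ (fromℕR-+ m n)) (sym (+-assoc _ _ _))

  binomialTerm : ℕ → Carrier → Carrier → ℕ → Carrier
  binomialTerm d a b i = signR R i (fromℕR R (d C i) * (powR R a (d ℕ.∸ i) * powR R b i))

  module _ where
    open import Algebra.Solver.Ring.NaturalCoefficients.Default commutativeSemiring
      using (solve; _:*_; _:+_; _:=_)

    -- When j ≥ d the exponent d ∸ j is truncated, but then the coefficient d C (1 + j) vanishes.
    powR-∸-unfold : ∀ d j a → fromℕR R (d C suc j) * powR R a (d ℕ.∸ j)
                              ≈ fromℕR R (d C suc j) * (a * powR R a (d ℕ.∸ suc j))
    powR-∸-unfold d j a with suc j ℕ.≤? d
    ... | yes j<d =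
      reflexive (cong (λ e → fromℕR R (d C suc j) * powR R a e) (ℕP.+-∸-assoc 1 j<d))
    ... | no j≮d =
      trans (*-congʳ C≈0) (trans (zeroˡ _) (sym (trans (*-congʳ C≈0) (zeroˡ _))))
      where
      C≈0 : fromℕR R (d C suc j) ≈ 0#
      C≈0 = reflexive (cong (fromℕR R) (k>n⇒nCk≡0 (ℕP.≰⇒> j≮d)))

    binomialTerm-pascal : ∀ d j a b →
      binomialTerm (suc d) a b (suc j) ≈ a * binomialTerm d a b (suc j) + - (b * binomialTerm d a b j)
    binomialTerm-pascal d j a b = begin
      signR R (suc j) (fromℕR R (suc d C suc j) * (A * (b * B)))   ≈⟨ signR-suc j _ ⟩
      - signR R j (fromℕR R (suc d C suc j) * (A * (b * B)))       ≈⟨ -‿cong (signR≈sign1* j _) ⟩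
      - (s * (fromℕR R (suc d C suc j) * (A * (b * B))))           ≈⟨ -‿cong (*-congˡ (*-congʳ pascal)) ⟩
      - (s * ((p + q) * (A * (b * B))))                             ≈⟨ -‿cong (expand s p q A b B) ⟩
      - (b * (s * (p * (A * B))) + (s * b * B) * (q * A))           ≈⟨ -‿cong (+-congˡ (*-congˡ (powR-∸-unfold d j a))) ⟩
      - (b * (s * (p * (A * B))) + (s * b * B) * (q * (a * A′)))    ≈⟨ -‿cong (regroup s p q A b B a A′) ⟩
      - (a * (s * (q * (A′ * (b * B)))) + b * (s * (p * (A * B)))) ≈⟨ sym (-‿+-comm _ _) ⟩
      - (a * (s * (q * (A′ * (b * B))))) + - (b * (s * (p * (A * B))))
        ≈⟨ +-cong (trans (-‿distribʳ-* _ _) (*-congˡ (trans (sym (-‿cong (signR≈sign1* j _))) (sym (signR-suc j _)))))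
                  (-‿cong (*-congˡ (sym (signR≈sign1* j _)))) ⟩
      a * binomialTerm d a b (suc j) + - (b * binomialTerm d a b j) ∎
      where
      s : Carrier
      s = signR R j 1#
      p : Carrier
      p = fromℕR R (d C j)
      q : Carrier
      q = fromℕR R (d C suc j)
      A : Carrier
      A = powR R a (d ℕ.∸ j)
      A′ : Carrier
      A′ = powR R a (d ℕ.∸ suc j)
      B : Carrier
      B = powR R b j
      pascal : fromℕR R (suc d C suc j) ≈ p + q
      pascal = trans (reflexive (cong (fromℕR R) (≡.sym (nCk+nC[k+1]≡[n+1]C[k+1] d j)))) (fromℕR-+ (d C j) (d C suc j))
      expand : ∀ s p q A b B → s * ((p + q) * (A * (b * B))) ≈ b * (s * (p * (A * B))) + (s * b * B) * (q * A)
      expand = solve 6 (λ s p q A b B → s :* ((p :+ q) :* (A :* (b :* B)))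
                                     := b :* (s :* (p :* (A :* B))) :+ (s :* b :* B) :* (q :* A)) ≈-refl
      regroup : ∀ s p q A b B a A′ →
        b * (s * (p * (A * B))) + (s * b * B) * (q * (a * A′)) ≈ a * (s * (q * (A′ * (b * B)))) + b * (s * (p * (A * B)))
      regroup = solve 8 (λ s p q A b B a A′ → b :* (s :* (p :* (A :* B))) :+ (s :* b :* B) :* (q :* (a :* A′))
                                           := a :* (s :* (q :* (A′ :* (b :* B)))) :+ b :* (s :* (p :* (A :* B)))) ≈-refl

  binomialTerm-0 : ∀ d a b → binomialTerm d a b 0 ≈ powR R a d
  binomialTerm-0 d a b = trans (*-congʳ (+-identityʳ 1#)) (trans (*-identityˡ _) (*-identityʳ _))

  binomialTerm-top : ∀ d a b → binomialTerm d a b (suc d) ≈ 0#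
  binomialTerm-top d a b = trans (signR≈sign1* (suc d) _) (trans (*-congˡ C≈0) (zeroʳ _))
    where
    C≈0 : fromℕR R (d C suc d) * (powR R a (d ℕ.∸ suc d) * powR R b (suc d)) ≈ 0#
    C≈0 = trans (*-congʳ (reflexive (cong (fromℕR R) (k>n⇒nCk≡0 (ℕP.n<1+n d))))) (zeroˡ _)

  binomial-difference : ∀ d a b → ∑ (upTo (suc d)) (binomialTerm d a b) ≈ powR R (a - b) d
  binomial-difference zero    a b = trans (+-identityʳ _) (binomialTerm-0 0 a b)
  binomial-difference (suc d) a b = begin
    ∑ (upTo (suc (suc d))) (binomialTerm (suc d) a b)
      ≈⟨ ∑-upTo-suc (suc d) _ ⟩
    binomialTerm (suc d) a b 0 + ∑ (upTo (suc d)) (λ j → binomialTerm (suc d) a b (suc j))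
      ≈⟨ +-cong (binomialTerm-0 (suc d) a b) (∑-cong (upTo (suc d)) (λ j → binomialTerm-pascal d j a b)) ⟩
    a * powR R a d + ∑ (upTo (suc d)) (λ j → a * t (suc j) + - (b * t j))
      ≈⟨ +-congˡ (∑-+ (upTo (suc d)) _ _) ⟩
    a * powR R a d + (∑ (upTo (suc d)) (λ j → a * t (suc j)) + ∑ (upTo (suc d)) (λ j → - (b * t j)))
      ≈⟨ +-congˡ (+-cong (∑-*ˡ (upTo (suc d)) a _) (trans (∑-neg (upTo (suc d)) _) (-‿cong (∑-*ˡ (upTo (suc d)) b _)))) ⟩
    a * powR R a d + (a * shifted + - (b * ∑ (upTo (suc d)) t))
      ≈⟨ sym (+-assoc _ _ _) ⟩
    (a * powR R a d + a * shifted) + - (b * ∑ (upTo (suc d)) t)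
      ≈⟨ +-cong (sym (distribˡ a _ _)) (-‿cong (*-congˡ (binomial-difference d a b))) ⟩
    a * (powR R a d + shifted) + - (b * Z)
      ≈⟨ +-congʳ (*-congˡ head+shifted) ⟩
    a * Z + - (b * Z)
      ≈⟨ +-congˡ (-‿distribˡ-* b Z) ⟩
    a * Z + (- b) * Z
      ≈⟨ sym (distribʳ Z a (- b)) ⟩
    (a - b) * Z ∎
    where
    t : ℕ → Carrier
    t = binomialTerm d a b
    Z : Carrier
    Z = powR R (a - b) d
    shifted : Carrier
    shifted = ∑ (upTo (suc d)) (λ j → t (suc j))
    head+shifted : powR R a d + shifted ≈ Z
    head+shifted = begin
      powR R a d + shifted           ≈⟨ +-congʳ (sym (binomialTerm-0 d a b)) ⟩
      t 0 + shifted                  ≈⟨ sym (∑-upTo-suc (suc d) t) ⟩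
      ∑ (upTo (suc (suc d))) t       ≈⟨ ∑-upTo-last (suc d) t ⟩
      ∑ (upTo (suc d)) t + t (suc d) ≈⟨ +-cong (binomial-difference d a b) (binomialTerm-top d a b) ⟩
      Z + 0#                         ≈⟨ +-identityʳ Z ⟩
      Z                              ∎

Assignment : Set
Assignment = ℕ → ℕ

_[_≔_] : Assignment → ℕ → ℕ → Assignment
(ρ [ v ≔ k ]) a = if a ≡ᵇ v then k else ρ a

update-same : ∀ ρ v k → (ρ [ v ≔ k ]) v ≡ k
update-same ρ v k rewrite ≡ᵇ-refl v = refl

update-other : ∀ ρ {v} k a → (a ≡ᵇ v) ≡ false → (ρ [ v ≔ k ]) a ≡ ρ a
update-other ρ k a a≢v rewrite a≢v = refl

update-cong : ∀ {ρ ρ′} v {k k′} → ρ ≡.≗ ρ′ → k ≡ k′ → ρ [ v ≔ k ] ≡.≗ ρ′ [ v ≔ k′ ]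
update-cong v ρ≗ρ′ refl a with a ≡ᵇ v
... | true  = refl
... | false = ρ≗ρ′ a

update-comm : ∀ ρ {u} k {v} l → (u ≡ᵇ v) ≡ false → ρ [ u ≔ k ] [ v ≔ l ] ≡.≗ ρ [ v ≔ l ] [ u ≔ k ]
update-comm ρ {u} k {v} l u≢v a with a ≡ᵇ v in a≡v | a ≡ᵇ u in a≡u
... | true  | true  with refl ← ≡ᵇ-true⇒≡ a v a≡v | refl ← ≡ᵇ-true⇒≡ a u a≡u
                    with () ← ≡.trans (≡.sym (≡ᵇ-refl a)) u≢v
... | true  | false = refl
... | false | true  = refl
... | false | false = refl

Valid : Mark → Set
Valid (w , d) = suc d ℕ.≤ w

valid-∔ : ∀ m m′ → Valid m → Valid m′ → Valid (m ∔ m′)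
valid-∔ (w , d) (w′ , d′) d<w d′<w′ =
  subst (ℕ._≤ w ℕ.+ w′) (suc-+-suc d d′) (ℕP.+-mono-≤ d<w d′<w′)
  where
  suc-+-suc : ∀ a b → suc a ℕ.+ suc b ≡ suc (a ℕ.+ b ℕ.+ 1)
  suc-+-suc = solve-∀

markOf-valid : ∀ u {vs} → All (Valid ∘ proj₂) vs → Valid (markOf u vs)
markOf-valid u []                           = ℕ.s≤s ℕ.z≤n
markOf-valid u {(v , m) ∷ vs} (m-valid ∷ ok) with u ≡ᵇ v
... | true  = m-valid
... | false = markOf-valid u ok

valid-removeV : ∀ u {vs} → All (Valid ∘ proj₂) vs → All (Valid ∘ proj₂) (removeV u vs)
valid-removeV u []                           = []
valid-removeV u {(v , m) ∷ vs} (m-valid ∷ ok) with u ≡ᵇ v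
... | true  = valid-removeV u ok
... | false = m-valid ∷ valid-removeV u ok

valid-setMark : ∀ u {M vs} → Valid M → All (Valid ∘ proj₂) vs → All (Valid ∘ proj₂) (setMark u M vs)
valid-setMark u M-valid []                           = []
valid-setMark u {vs = (v , m) ∷ vs} M-valid (m-valid ∷ ok) with u ≡ᵇ v
... | true  = M-valid ∷ valid-setMark u M-valid ok
... | false = m-valid ∷ valid-setMark u M-valid ok

Endpoints : List (ℕ × Mark) → Edge → Set
Endpoints vs (a , b) = (occurs a vs ≡ true) × (occurs b vs ≡ true)

record WellFormed (vs : List (ℕ × Mark)) (es : List Edge) : Set where
  field
    distinct  : Distinct vs
    valid     : All (Valid ∘ proj₂) vs
    endpoints : All (Endpoints vs) es
open WellFormed

occurs-contractVerts : ∀ u v vs a → occurs u vs ≡ true → (u ≡ᵇ v) ≡ false → occurs a vs ≡ true →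
                       occurs (if a ≡ᵇ v then u else a) (contractVerts u v vs) ≡ true
occurs-contractVerts u v vs a u∈ u≢v a∈ with a ≡ᵇ v in a≢v
... | true  = ≡.trans (occurs-setMark u u _ (removeV v vs)) (≡.trans (occurs-removeV vs u≢v) u∈)
... | false = ≡.trans (occurs-setMark a u _ (removeV v vs)) (≡.trans (occurs-removeV vs a≢v) a∈)

endpoints-renameE : ∀ u v vs es → occurs u vs ≡ true → (u ≡ᵇ v) ≡ false →
                    All (Endpoints vs) es → All (Endpoints (contractVerts u v vs)) (renameE v u es)
endpoints-renameE u v vs []             u∈ u≢v []                  = []
endpoints-renameE u v vs ((a , b) ∷ es) u∈ u≢v ((a∈ , b∈) ∷ ends) =
  (occurs-contractVerts u v vs a u∈ u≢v a∈ , occurs-contractVerts u v vs b u∈ u≢v b∈) ∷ endpoints-renameE u v vs es u∈ u≢v ends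

WellFormed-contract : ∀ {vs u v es} → WellFormed vs ((u , v) ∷ es) → (u ≡ᵇ v) ≡ false →
                      WellFormed (contractVerts u v vs) (renameE v u es)
WellFormed-contract {vs} {u} {v} {es} wf u≢v with (u∈ , v∈) ∷ ends ← endpoints wf = record
  { distinct  = Distinct-setMark u _ (Distinct-removeV v (distinct wf))
  ; valid     = valid-setMark u (valid-∔ _ _ (markOf-valid u (valid wf)) (markOf-valid v (valid wf)))
                              (valid-removeV v (valid wf))
  ; endpoints = endpoints-renameE u v vs es u∈ u≢v ends
  }

indicator : Bool → ℕ
indicator b = if b then 1 else 0

degree-middle : ∀ v A e B → degree v (A ++ e ∷ B) ≡ degree v (e ∷ A ++ B)
degree-middle v []             e       B = refl
degree-middle v ((a , b) ∷ A) (c , d) B =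
  ≡.trans (cong (indicator (a ≡ᵇ v) ℕ.+ indicator (b ≡ᵇ v) ℕ.+_) (degree-middle v A (c , d) B))
          (swap (indicator (a ≡ᵇ v) ℕ.+ indicator (b ≡ᵇ v)) (indicator (c ≡ᵇ v) ℕ.+ indicator (d ≡ᵇ v)) (degree v (A ++ B)))
  where
  swap : ∀ p q r → p ℕ.+ (q ℕ.+ r) ≡ q ℕ.+ (p ℕ.+ r)
  swap = solve-∀

degree-flip : ∀ v a b L → degree v ((a , b) ∷ L) ≡ degree v ((b , a) ∷ L)
degree-flip v a b L = cong (ℕ._+ degree v L) (ℕP.+-comm (indicator (a ≡ᵇ v)) (indicator (b ≡ᵇ v)))

degree-leaf : ∀ v u L → degree v ((u , v) ∷ L) ≡ 1 → ((u ≡ᵇ v) ≡ false) × (degree v L ≡ 0)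
degree-leaf v u L deg rewrite ≡ᵇ-refl v with u ≡ᵇ v
... | false = refl , ℕP.suc-injective deg
... | true with () ← ℕP.suc-injective deg

degree-zero⁻ : ∀ v a b L → degree v ((a , b) ∷ L) ≡ 0 → ((a ≡ᵇ v) ≡ false) × ((b ≡ᵇ v) ≡ false) × (degree v L ≡ 0)
degree-zero⁻ v a b L deg with a ≡ᵇ v | b ≡ᵇ v
... | false | false = refl , refl , deg

Joins : Edge → ℕ → ℕ → Set
Joins e u v = (e ≡ (u , v)) ⊎ (e ≡ (v , u))

Joins-degree : ∀ {e u v} L → Joins e u v → degree v (e ∷ L) ≡ degree v ((u , v) ∷ L)
Joins-degree L (inj₁ refl) = refl
Joins-degree {u = u} {v} L (inj₂ refl) = degree-flip v v u L

Joins-endpoints : ∀ {e u v vs} → Joins e u v → Endpoints vs e → Endpoints vs (u , v)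
Joins-endpoints (inj₁ refl) ends          = ends
Joins-endpoints (inj₂ refl) (v∈ , u∈) = u∈ , v∈

endpoints-absorb : ∀ u M v vs L → All (Endpoints vs) L → degree v L ≡ 0 →
                   All (Endpoints (setMark u M (removeV v vs))) L
endpoints-absorb u M v vs []             []                  _   = []
endpoints-absorb u M v vs ((a , b) ∷ L) ((a∈ , b∈) ∷ ends) deg with degree-zero⁻ v a b L deg
... | a≢v , b≢v , deg′ =
  ( ≡.trans (occurs-setMark a u M (removeV v vs)) (≡.trans (occurs-removeV vs a≢v) a∈)
  , ≡.trans (occurs-setMark b u M (removeV v vs)) (≡.trans (occurs-removeV vs b≢v) b∈))
  ∷ endpoints-absorb u M v vs L ends deg′

pickAbs-just : ∀ G acc es {u v es′} → pickAbs G acc es ≡ just (u , v , es′) →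
  Σ (List Edge) λ A → Σ Edge λ e → Σ (List Edge) λ B →
    (reverse acc ++ es ≡ A ++ e ∷ B) × (es′ ≡ A ++ B) × Joins e u v × (absorbableV G v ≡ true)
pickAbs-just G acc ((a , b) ∷ es) picked with absorbableV G b in b-abs
... | true with refl ← picked = reverse acc , (a , b) , es , refl , refl , inj₁ refl , b-abs
... | false with absorbableV G a in a-abs
...   | true with refl ← picked = reverse acc , (a , b) , es , refl , refl , inj₂ refl , a-abs
...   | false with pickAbs-just G ((a , b) ∷ acc) es picked
...     | A , e , B , split , rest , joins , v-abs = A , e , B , ≡.trans (≡.sym shift) split , rest , joins , v-abs
  where
  shift : reverse ((a , b) ∷ acc) ++ es ≡ reverse acc ++ (a , b) ∷ es
  shift = ≡.trans (cong (_++ es) (LP.unfold-reverse (a , b) acc)) (LP.++-assoc (reverse acc) [ (a , b) ] es)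

absorbableV-spec : ∀ G v → absorbableV G v ≡ true → (degree v (edges G) ≡ 1) × (markOf v (verts G) ≡ (1 , 0))
absorbableV-spec G v abs with ∧-true⁻ abs
... | deg≡1 , mark≡ with ∧-true⁻ mark≡
...   | w≡1 , d≡0 =
  ≡ᵇ-true⇒≡ _ 1 deg≡1 , cong₂ _,_ (≡ᵇ-true⇒≡ _ 1 w≡1) (≡ᵇ-true⇒≡ _ 0 d≡0)

grow : Mark → Mark
grow m = (suc (proj₁ m) , proj₂ m)

record Absorption (G G′ : MGraph) : Set where
  field
    root leaf     : ℕ
    edge          : Edge
    before after  : List Edge
    edges-split   : edges G ≡ before ++ edge ∷ after
    joins         : Joins edge root leaf
    root≢leaf     : (root ≡ᵇ leaf) ≡ false
    leaf-mark     : markOf leaf (verts G) ≡ (1 , 0)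
    leaf-isolated : degree leaf (before ++ after) ≡ 0
    result        : G′ ≡ mgraph (setMark root (grow (markOf root (verts G))) (removeV leaf (verts G))) (before ++ after)

absorbStep-absorption : ∀ G {G′} → absorbStep G ≡ just G′ → Absorption G G′
absorbStep-absorption G step with pickAbs G [] (edges G) in picked
absorbStep-absorption G refl | just (u , v , es′) with pickAbs-just G [] (edges G) picked
... | A , e , B , split , refl , joins , v-abs with absorbableV-spec G v v-abs
...   | deg≡1 , leaf-mark with degree-leaf v u (A ++ B) (≡.trans (≡.sym (Joins-degree (A ++ B) joins))
                                 (≡.trans (≡.sym (degree-middle v A e B)) (≡.trans (cong (degree v) (≡.sym split)) deg≡1)))
...     | u≢v , isolated = record
  { root = u ; leaf = v ; edge = e ; before = A ; after = B ; edges-split = split ; joins = joins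
  ; root≢leaf = u≢v ; leaf-mark = leaf-mark ; leaf-isolated = isolated ; result = refl }

WellFormed-absorb : ∀ {G G′} → Absorption G G′ → WellFormed (verts G) (edges G) → WellFormed (verts G′) (edges G′)
WellFormed-absorb {G} record { root = u ; leaf = v ; edge = e ; before = A ; after = B ; edges-split = split
                             ; leaf-isolated = isolated ; result = refl } wf = record
  { distinct  = Distinct-setMark u _ (Distinct-removeV v (distinct wf))
  ; valid     = valid-setMark u (ℕP.m≤n⇒m≤1+n (markOf-valid u (valid wf))) (valid-removeV v (valid wf))
  ; endpoints = endpoints-absorb u _ v (verts G) (A ++ B) (All.++⁺ (All.++⁻ˡ A ends) (All.tail (All.++⁻ʳ A ends))) isolated
  }
  where
  ends : All (Endpoints (verts G)) (A ++ e ∷ B)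
  ends = subst (All (Endpoints (verts G))) split (endpoints wf)

WellFormed-coreFuel : ∀ f G → WellFormed (verts G) (edges G) → WellFormed (verts (coreFuel f G)) (edges (coreFuel f G))
WellFormed-coreFuel zero    G wf = wf
WellFormed-coreFuel (suc f) G wf with absorbStep G in step
... | nothing = wf
... | just G′ = WellFormed-coreFuel f G′ (WellFormed-absorb (absorbStep-absorption G step) wf)

extend : ∀ {n N} → Assignment → (Fin n → ℕ) → (Fin n → Fin N) → Assignment
extend {zero}  ρ g κ = ρ
extend {suc n} ρ g κ = extend (ρ [ g fzero ≔ toℕ (κ fzero) ]) (g ∘ fsuc) (κ ∘ fsuc)

Injective : ∀ {n} → (Fin n → ℕ) → Set
Injective g = ∀ i j → g i ≡ g j → i ≡ j

toℕ-Injective : ∀ {n} → Injective (toℕ {n})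
toℕ-Injective i j = FP.toℕ-injective

Injective-suc : ∀ {n} {g : Fin (suc n) → ℕ} → Injective g → Injective (g ∘ fsuc)
Injective-suc g-inj i j gi≡gj = FP.suc-injective (g-inj (fsuc i) (fsuc j) gi≡gj)

Injective-head : ∀ {n} {g : Fin (suc n) → ℕ} → Injective g → ∀ i → (g fzero ≡ᵇ g (fsuc i)) ≡ false
Injective-head g-inj i = ≢⇒≡ᵇ-false (FP.0≢1+n ∘ g-inj fzero (fsuc i))

extend-outside : ∀ {n N} ρ (g : Fin n → ℕ) (κ : Fin n → Fin N) a → (∀ i → (a ≡ᵇ g i) ≡ false) → extend ρ g κ a ≡ ρ a
extend-outside {zero}  ρ g κ a a∉ = refl
extend-outside {suc n} ρ g κ a a∉ =
  ≡.trans (extend-outside _ (g ∘ fsuc) (κ ∘ fsuc) a (a∉ ∘ fsuc)) (update-other ρ _ a (a∉ fzero))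

extend-at : ∀ {n N} ρ (g : Fin n → ℕ) (κ : Fin n → Fin N) → Injective g → ∀ i → extend ρ g κ (g i) ≡ toℕ (κ i)
extend-at {suc n} ρ g κ g-inj fzero =
  ≡.trans (extend-outside _ (g ∘ fsuc) (κ ∘ fsuc) (g fzero) (Injective-head g-inj)) (update-same ρ (g fzero) _)
extend-at {suc n} ρ g κ g-inj (fsuc i) = extend-at _ (g ∘ fsuc) (κ ∘ fsuc) (Injective-suc g-inj) i

unmarked : ∀ {n} → (Fin n → ℕ) → List (ℕ × Mark)
unmarked g = tabulate (λ i → (g i , (1 , 0)))

occurs-unmarked-false : ∀ {n} (g : Fin n → ℕ) a → (∀ i → (a ≡ᵇ g i) ≡ false) → occurs a (unmarked g) ≡ false
occurs-unmarked-false {zero}  g a a∉ = refl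
occurs-unmarked-false {suc n} g a a∉ rewrite a∉ fzero = occurs-unmarked-false (g ∘ fsuc) a (a∉ ∘ fsuc)

occurs-unmarked : ∀ {n} (g : Fin n → ℕ) i → occurs (g i) (unmarked g) ≡ true
occurs-unmarked g fzero    rewrite ≡ᵇ-refl (g fzero) = refl
occurs-unmarked g (fsuc i) rewrite occurs-unmarked (g ∘ fsuc) i = BP.∨-zeroʳ _

Distinct-unmarked : ∀ {n} (g : Fin n → ℕ) → Injective g → Distinct (unmarked g)
Distinct-unmarked {zero}  g g-inj = []
Distinct-unmarked {suc n} g g-inj =
  occurs-unmarked-false (g ∘ fsuc) (g fzero) (Injective-head g-inj) ∷ Distinct-unmarked (g ∘ fsuc) (Injective-suc g-inj)

valid-unmarked : ∀ {n} (g : Fin n → ℕ) → All (Valid ∘ proj₂) (unmarked g)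
valid-unmarked {zero}  g = []
valid-unmarked {suc n} g = ℕ.s≤s ℕ.z≤n ∷ valid-unmarked (g ∘ fsuc)

verts-marked𝟙 : ∀ {n} (G : SimpleGraph n) → verts (marked𝟙 G) ≡ unmarked toℕ
verts-marked𝟙 G = LP.map-tabulate id (λ i → (toℕ i , (1 , 0)))

Bool-≡ : ∀ {a b : Bool} → (a ≡ true → b ≡ true) → (b ≡ true → a ≡ true) → a ≡ b
Bool-≡ {true}  {true}  _ _ = refl
Bool-≡ {true}  {false} a⇒b _ = ≡.sym (a⇒b refl)
Bool-≡ {false} {true}  _ b⇒a = b⇒a refl
Bool-≡ {false} {false} _ _ = refl

not-true⇒false : ∀ {b} → not b ≡ true → b ≡ false
not-true⇒false {false} _ = refl

and-true⁻ : ∀ {L b} → and L ≡ true → b ∈ L → b ≡ true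
and-true⁻ {c ∷ L} all-true (here refl) = proj₁ (∧-true⁻ all-true)
and-true⁻ {c ∷ L} all-true (there b∈) = and-true⁻ (proj₂ (∧-true⁻ {c} all-true)) b∈

and-true⁺ : ∀ L → (∀ {b} → b ∈ L → b ≡ true) → and L ≡ true
and-true⁺ []      _        = refl
and-true⁺ (c ∷ L) all-true rewrite all-true (here refl) = and-true⁺ L (all-true ∘ there)

ProperColouring : ∀ {n N} → SimpleGraph n → (Fin n → Fin N) → Set
ProperColouring G κ = ∀ i j → adj G i j ≡ true → (toℕ (κ i) ≡ᵇ toℕ (κ j)) ≡ false

module _ {n N : ℕ} (G : SimpleGraph n) (κ : Fin n → Fin N) where
  private
    pairOk : Fin n → Fin n → Bool
    pairOk i j = not (adj G i j ∧ (toℕ (κ i) ≡ᵇ toℕ (κ j)))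

    pairOk-∈ : ∀ i j → pairOk i j ∈ concatMap (λ i → map (pairOk i) (allFin n)) (allFin n)
    pairOk-∈ i j = ∈-concat⁺′ (∈-map⁺ (pairOk i) (∈-allFin j)) (∈-map⁺ (λ i → map (pairOk i) (allFin n)) (∈-allFin i))

  properᵇ-sound : properᵇ G κ ≡ true → ProperColouring G κ
  properᵇ-sound proper i j ij∈E =
    not-true⇒false (subst (λ t → not (t ∧ (toℕ (κ i) ≡ᵇ toℕ (κ j))) ≡ true) ij∈E (and-true⁻ proper (pairOk-∈ i j)))

  properᵇ-complete : ProperColouring G κ → properᵇ G κ ≡ true
  properᵇ-complete proper = and-true⁺ _ pairOk-true
    where
    pairOk-true : ∀ {b} → b ∈ concatMap (λ i → map (pairOk i) (allFin n)) (allFin n) → b ≡ true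
    pairOk-true b∈ with _ , b∈row , row∈ ← ∈-concat⁻′ (map (λ i → map (pairOk i) (allFin n)) (allFin n)) b∈
                   with i , _ , refl ← ∈-map⁻ (λ i → map (pairOk i) (allFin n)) row∈
                   with j , _ , refl ← ∈-map⁻ (pairOk i) b∈row
                   with adj G i j in ij∈E
    ... | true  rewrite proper i j ij∈E = refl
    ... | false = refl

edgesDistinctᵇ : List Edge → Assignment → Bool
edgesDistinctᵇ []             ρ = true
edgesDistinctᵇ ((a , b) ∷ es) ρ = not (ρ a ≡ᵇ ρ b) ∧ edgesDistinctᵇ es ρ

edgesDistinctᵇ-sound : ∀ {es ρ e} → edgesDistinctᵇ es ρ ≡ true → e ∈ es → (ρ (proj₁ e) ≡ᵇ ρ (proj₂ e)) ≡ false
edgesDistinctᵇ-sound {(a , b) ∷ es} ok (here refl) = not-true⇒false (proj₁ (∧-true⁻ ok))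
edgesDistinctᵇ-sound {(a , b) ∷ es} ok (there e∈) = edgesDistinctᵇ-sound (proj₂ (∧-true⁻ {not _} ok)) e∈

edgesDistinctᵇ-complete : ∀ es ρ → (∀ {e} → e ∈ es → (ρ (proj₁ e) ≡ᵇ ρ (proj₂ e)) ≡ false) → edgesDistinctᵇ es ρ ≡ true
edgesDistinctᵇ-complete []             ρ ok = refl
edgesDistinctᵇ-complete ((a , b) ∷ es) ρ ok rewrite ok (here refl) = edgesDistinctᵇ-complete es ρ (ok ∘ there)

module _ {n : ℕ} (G : SimpleGraph n) where
  private
    upper : Fin n → Fin n → Bool
    upper i j = (toℕ i <ᵇ toℕ j) ∧ adj G i j

    row : Fin n → List Edge
    row i = map (λ j → (toℕ i , toℕ j)) (filter (λ j → upper i j BP.≟ true) (allFin n))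

  edgeList-∈⁺ : ∀ i j → toℕ i ℕ.< toℕ j → adj G i j ≡ true → (toℕ i , toℕ j) ∈ edgeList G
  edgeList-∈⁺ i j i<j ij∈E = ∈-concat⁺′
    (∈-map⁺ (λ j → (toℕ i , toℕ j)) (∈-filter⁺ (λ j → upper i j BP.≟ true) (∈-allFin j)
      (cong₂ _∧_ (Equivalence.to BP.T-≡ (ℕP.<⇒<ᵇ i<j)) ij∈E)))
    (∈-map⁺ row (∈-allFin i))

  edgeList-∈⁻ : ∀ {e} → e ∈ edgeList G → Σ (Fin n) λ i → Σ (Fin n) λ j → (e ≡ (toℕ i , toℕ j)) × (adj G i j ≡ true)
  edgeList-∈⁻ e∈ with _ , e∈row , row∈ ← ∈-concat⁻′ (map row (allFin n)) e∈
                 with i , _ , refl ← ∈-map⁻ row row∈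
                 with j , j∈ , refl ← ∈-map⁻ (λ j → (toℕ i , toℕ j)) e∈row =
    i , j , refl , proj₂ (∧-true⁻ (proj₂ (∈-filter⁻ (λ j → upper i j BP.≟ true) {xs = allFin n} j∈)))

  WellFormed-marked𝟙 : WellFormed (verts (marked𝟙 G)) (edges (marked𝟙 G))
  WellFormed-marked𝟙 rewrite verts-marked𝟙 G = record
    { distinct  = Distinct-unmarked toℕ toℕ-Injective
    ; valid     = valid-unmarked toℕ
    ; endpoints = All.tabulate ends
    }
    where
    ends : ∀ {e} → e ∈ edgeList G → Endpoints (unmarked (toℕ {n})) e
    ends e∈ with i , j , refl , _ ← edgeList-∈⁻ e∈ = occurs-unmarked toℕ i , occurs-unmarked toℕ j

  module _ {N : ℕ} (κ : Fin n → Fin N) (ρ : Assignment) (ρ-κ : ∀ i → ρ (toℕ i) ≡ toℕ (κ i)) where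
    private
      colours-differ : ∀ i j → (ρ (toℕ i) ≡ᵇ ρ (toℕ j)) ≡ (toℕ (κ i) ≡ᵇ toℕ (κ j))
      colours-differ i j = cong₂ _≡ᵇ_ (ρ-κ i) (ρ-κ j)

      edges-proper : edgesDistinctᵇ (edgeList G) ρ ≡ true → ProperColouring G κ
      edges-proper ok i j ij∈E with ℕP.<-cmp (toℕ i) (toℕ j)
      ... | tri< i<j _ _ = ≡.trans (≡.sym (colours-differ i j)) (edgesDistinctᵇ-sound ok (edgeList-∈⁺ i j i<j ij∈E))
      ... | tri≈ _ i≡j _ with refl ← FP.toℕ-injective i≡j with () ← ≡.trans (≡.sym ij∈E) (adj-irrefl G i)
      ... | tri> _ _ j<i = ≡.trans (≡ᵇ-sym (toℕ (κ i)) (toℕ (κ j))) (≡.trans (≡.sym (colours-differ j i))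
                             (edgesDistinctᵇ-sound ok (edgeList-∈⁺ j i j<i (≡.trans (adj-sym G j i) ij∈E))))

      proper-edges : ProperColouring G κ → edgesDistinctᵇ (edgeList G) ρ ≡ true
      proper-edges proper = edgesDistinctᵇ-complete (edgeList G) ρ ok
        where
        ok : ∀ {e} → e ∈ edgeList G → (ρ (proj₁ e) ≡ᵇ ρ (proj₂ e)) ≡ false
        ok e∈ with i , j , refl , ij∈E ← edgeList-∈⁻ e∈ = ≡.trans (colours-differ i j) (proper i j ij∈E)

    properᵇ≡edgesDistinctᵇ : properᵇ G κ ≡ edgesDistinctᵇ (edgeList G) ρ
    properᵇ≡edgesDistinctᵇ = Bool-≡ (proper-edges ∘ properᵇ-sound G κ) (properᵇ-complete G κ ∘ edges-proper)

spokes : ℕ → List Edge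
spokes k = tabulate (λ (j : Fin k) → (0 , suc (toℕ j)))

module _ {k : ℕ} where
  private
    row : Fin (suc k) → List Edge
    row i = map (λ j → (toℕ i , toℕ j))
                (filter (λ j → ((toℕ i <ᵇ toℕ j) ∧ adj (Star (suc k)) i j) BP.≟ true) (allFin (suc k)))

    centre-row : ∀ {m} (h : Fin m → Fin k) →
      filter (λ j → ((0 <ᵇ toℕ j) ∧ adj (Star (suc k)) fzero j) BP.≟ true) (tabulate (fsuc ∘ h)) ≡ tabulate (fsuc ∘ h)
    centre-row {zero}  h = refl
    centre-row {suc m} h = cong (fsuc (h fzero) ∷_) (centre-row (h ∘ fsuc))

    leaf-row : ∀ (i : Fin k) {m} (h : Fin m → Fin k) →
      filter (λ j → ((toℕ (fsuc i) <ᵇ toℕ j) ∧ adj (Star (suc k)) (fsuc i) j) BP.≟ true) (tabulate (fsuc ∘ h)) ≡ []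
    leaf-row i {zero}  h = refl
    leaf-row i {suc m} h rewrite BP.∧-zeroʳ (toℕ i <ᵇ toℕ (h fzero)) = leaf-row i (h ∘ fsuc)

    leaf-rows : ∀ {m} (h : Fin m → Fin k) → concatMap row (tabulate (fsuc ∘ h)) ≡ []
    leaf-rows {zero}  h = refl
    leaf-rows {suc m} h rewrite leaf-row (h fzero) (λ j → j) = leaf-rows (h ∘ fsuc)

  edgeList-Star : edgeList (Star (suc k)) ≡ spokes k
  edgeList-Star rewrite centre-row (λ j → j) | leaf-rows (λ j → j) =
    ≡.trans (LP.++-identityʳ _) (LP.map-tabulate fsuc (λ j → (0 , toℕ j)))

module ColourSums {c ℓ : Level} (R : CommutativeRing c ℓ) (N : ℕ) (x : Fin N → CommutativeRing.Carrier R) where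
  open CommutativeRing R renaming (refl to ≈-refl)
  open RingSums R
  open import Relation.Binary.Reasoning.Setoid setoid

  Σᶜ : (Fin N → Carrier) → Carrier
  Σᶜ = ∑ (allFin N)

  Σᶜ-cong : ∀ {f g : Fin N → Carrier} → (∀ k → f k ≈ g k) → Σᶜ f ≈ Σᶜ g
  Σᶜ-cong = ∑-cong (allFin N)

  p₁ : Carrier
  p₁ = Σᶜ x

  weight : Mark → Fin N → Carrier
  weight (w , d) k = signR R d (powR R (x k) (suc d) * powR R (p₁ - x k) (w ℕ.∸ suc d))

  stateSum : List (ℕ × Mark) → (Assignment → Carrier) → Assignment → Carrier
  stateSum []             φ ρ = φ ρ
  stateSum ((v , m) ∷ vs) φ ρ = Σᶜ (λ k → weight m k * stateSum vs φ (ρ [ v ≔ toℕ k ]))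

  Congruent : (Assignment → Carrier) → Set ℓ
  Congruent φ = ∀ {ρ ρ′} → ρ ≡.≗ ρ′ → φ ρ ≈ φ ρ′

  stateSum-cong : ∀ vs {φ ψ} → (∀ ρ → φ ρ ≈ ψ ρ) → ∀ ρ → stateSum vs φ ρ ≈ stateSum vs ψ ρ
  stateSum-cong []             φ≈ψ ρ = φ≈ψ ρ
  stateSum-cong ((v , m) ∷ vs) φ≈ψ ρ = Σᶜ-cong (λ k → *-congˡ (stateSum-cong vs φ≈ψ _))

  stateSum-congruent : ∀ vs {φ} → Congruent φ → Congruent (stateSum vs φ)
  stateSum-congruent []             φ-cong ρ≗ρ′ = φ-cong ρ≗ρ′
  stateSum-congruent ((v , m) ∷ vs) φ-cong ρ≗ρ′ =
    Σᶜ-cong (λ k → *-congˡ (stateSum-congruent vs φ-cong (update-cong v ρ≗ρ′ refl)))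

  stateSum-*ˡ : ∀ vs s φ ρ → stateSum vs (λ ρ → s * φ ρ) ρ ≈ s * stateSum vs φ ρ
  stateSum-*ˡ []             s φ ρ = ≈-refl
  stateSum-*ˡ ((v , m) ∷ vs) s φ ρ =
    trans (Σᶜ-cong (λ k → trans (*-congˡ (stateSum-*ˡ vs s φ _)) (x*yz≈y*xz _ s _))) (∑-*ˡ (allFin N) s _)

  stateSum-+ : ∀ vs φ ψ ρ → stateSum vs (λ ρ → φ ρ + ψ ρ) ρ ≈ stateSum vs φ ρ + stateSum vs ψ ρ
  stateSum-+ []             φ ψ ρ = ≈-refl
  stateSum-+ ((v , m) ∷ vs) φ ψ ρ =
    trans (Σᶜ-cong (λ k → trans (*-congˡ (stateSum-+ vs φ ψ _)) (distribˡ _ _ _))) (∑-+ (allFin N) _ _)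

  stateSum-neg : ∀ vs φ ρ → stateSum vs (λ ρ → - φ ρ) ρ ≈ - stateSum vs φ ρ
  stateSum-neg []             φ ρ = ≈-refl
  stateSum-neg ((v , m) ∷ vs) φ ρ =
    trans (Σᶜ-cong (λ k → trans (*-congˡ (stateSum-neg vs φ _)) (sym (-‿distribʳ-* _ _)))) (∑-neg (allFin N) _)

  stateSum-zero : ∀ vs {φ} → (∀ ρ → φ ρ ≈ 0#) → ∀ ρ → stateSum vs φ ρ ≈ 0#
  stateSum-zero []             φ≈0 ρ = φ≈0 ρ
  stateSum-zero ((v , m) ∷ vs) φ≈0 ρ = ∑-zero (allFin N) (λ k → trans (*-congˡ (stateSum-zero vs φ≈0 _)) (zeroʳ _))

  stateSum-Σᶜ : ∀ vs (f : Fin N → Assignment → Carrier) ρ →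
                stateSum vs (λ ρ → Σᶜ (λ k → f k ρ)) ρ ≈ Σᶜ (λ k → stateSum vs (f k) ρ)
  stateSum-Σᶜ []             f ρ = ≈-refl
  stateSum-Σᶜ ((v , m) ∷ vs) f ρ =
    trans (Σᶜ-cong (λ c → trans (*-congˡ (stateSum-Σᶜ vs f _)) (sym (∑-*ˡ (allFin N) _ _))))
          (∑-swap (allFin N) (allFin N) _)

  stateSum-one : ∀ vs ρ → stateSum vs (λ _ → 1#) ρ ≈ prodR R (map (λ p → Σᶜ (weight (proj₂ p))) vs)
  stateSum-one []             ρ = ≈-refl
  stateSum-one ((v , m) ∷ vs) ρ = trans (Σᶜ-cong (λ k → *-congˡ (stateSum-one vs _))) (∑-*ʳ (allFin N) _ _)

  stateSum-local : ∀ vs φ ψ ρ₀ → (∀ ρ → (∀ a → occurs a vs ≡ false → ρ a ≡ ρ₀ a) → φ ρ ≈ ψ ρ) →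
                   stateSum vs φ ρ₀ ≈ stateSum vs ψ ρ₀
  stateSum-local []             φ ψ ρ₀ φ≈ψ = φ≈ψ ρ₀ (λ _ _ → refl)
  stateSum-local ((v , m) ∷ vs) φ ψ ρ₀ φ≈ψ = Σᶜ-cong (λ k → *-congˡ (stateSum-local vs φ ψ _ (λ ρ ρ≈ →
    φ≈ψ ρ (λ a a∉ → ≡.trans (ρ≈ a (proj₂ (∨-false⁻ a∉))) (update-other ρ₀ (toℕ k) a (proj₁ (∨-false⁻ a∉)))))))

  stateSum-update : ∀ vs φ u k → occurs u vs ≡ false → Congruent φ → ∀ ρ →
                    stateSum vs φ (ρ [ u ≔ k ]) ≈ stateSum vs (λ ρ → φ (ρ [ u ≔ k ])) ρ
  stateSum-update []             φ u k u∉ φ-cong ρ = ≈-refl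
  stateSum-update ((v , m) ∷ vs) φ u k u∉ φ-cong ρ = Σᶜ-cong (λ c → *-congˡ (trans
    (stateSum-congruent vs φ-cong (update-comm ρ k (toℕ c) (proj₁ (∨-false⁻ u∉))))
    (stateSum-update vs φ u k (proj₂ (∨-false⁻ u∉)) φ-cong _)))

  stateSum-extract : ∀ vs u φ → Distinct vs → occurs u vs ≡ true → Congruent φ → ∀ ρ →
    stateSum vs φ ρ ≈ Σᶜ (λ k → weight (markOf u vs) k * stateSum (removeV u vs) (λ ρ → φ (ρ [ u ≔ toℕ k ])) ρ)
  stateSum-extract ((v , m) ∷ vs) u φ (v∉ ∷ d) u∈ φ-cong ρ with u ≡ᵇ v in u≡v
  ... | true with refl ← ≡ᵇ-true⇒≡ u v u≡v rewrite removeV-absent u vs v∉ =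
    Σᶜ-cong (λ k → *-congˡ (stateSum-update vs φ u (toℕ k) v∉ φ-cong ρ))
  ... | false = begin
    Σᶜ (λ c → weight m c * stateSum vs φ (ρ [ v ≔ toℕ c ]))
      ≈⟨ Σᶜ-cong (λ c → *-congˡ (stateSum-extract vs u φ d u∈ φ-cong _)) ⟩
    Σᶜ (λ c → weight m c * Σᶜ (λ k → weight (markOf u vs) k * S k (ρ [ v ≔ toℕ c ])))
      ≈⟨ Σᶜ-cong (λ c → trans (sym (∑-*ˡ (allFin N) _ _)) (Σᶜ-cong (λ k → x*yz≈y*xz _ _ _))) ⟩
    Σᶜ (λ c → Σᶜ (λ k → weight (markOf u vs) k * (weight m c * S k (ρ [ v ≔ toℕ c ]))))
      ≈⟨ ∑-swap (allFin N) (allFin N) _ ⟩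
    Σᶜ (λ k → Σᶜ (λ c → weight (markOf u vs) k * (weight m c * S k (ρ [ v ≔ toℕ c ]))))
      ≈⟨ Σᶜ-cong (λ k → ∑-*ˡ (allFin N) _ _) ⟩
    Σᶜ (λ k → weight (markOf u vs) k * stateSum ((v , m) ∷ removeV u vs) (λ ρ → φ (ρ [ u ≔ toℕ k ])) ρ) ∎
    where
    S : Fin N → Assignment → Carrier
    S k = stateSum (removeV u vs) (λ ρ → φ (ρ [ u ≔ toℕ k ]))

  stateSum-pin : ∀ vs u k φ → Distinct vs → occurs u vs ≡ true → Congruent φ → ∀ ρ →
    stateSum vs (λ ρ → δ (ρ u) (toℕ k) * φ ρ) ρ
      ≈ weight (markOf u vs) k * stateSum (removeV u vs) (λ ρ → φ (ρ [ u ≔ toℕ k ])) ρ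
  stateSum-pin vs u k φ d u∈ φ-cong ρ = begin
    stateSum vs (λ ρ → δ (ρ u) (toℕ k) * φ ρ) ρ
      ≈⟨ stateSum-extract vs u _ d u∈ (λ ρ≗ρ′ → *-cong (reflexive (cong (λ a → δ a (toℕ k)) (ρ≗ρ′ u))) (φ-cong ρ≗ρ′)) ρ ⟩
    Σᶜ (λ c → weight m c * stateSum L (λ ρ → δ ((ρ [ u ≔ toℕ c ]) u) (toℕ k) * φ (ρ [ u ≔ toℕ c ])) ρ)
      ≈⟨ Σᶜ-cong (λ c → *-congˡ (trans (stateSum-cong L (λ ρ′ → *-congʳ (reflexive
           (cong (λ a → δ a (toℕ k)) (update-same ρ′ u (toℕ c))))) ρ) (stateSum-*ˡ L _ _ ρ))) ⟩
    Σᶜ (λ c → weight m c * (δ (toℕ c) (toℕ k) * S c))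
      ≈⟨ Σᶜ-cong (λ c → x*yz≈y*xz _ _ _) ⟩
    Σᶜ (λ c → δ (toℕ c) (toℕ k) * (weight m c * S c))
      ≈⟨ ∑-δ N k _ ⟩
    weight m k * S k ∎
    where
    m : Mark
    m = markOf u vs
    L : List (ℕ × Mark)
    L = removeV u vs
    S : Fin N → Carrier
    S c = stateSum L (λ ρ → φ (ρ [ u ≔ toℕ c ])) ρ

  weight-𝟙 : ∀ k → weight (1 , 0) k ≈ x k
  weight-𝟙 k = trans (*-identityʳ _) (*-identityʳ _)

  weightₑ : ℕ → ℕ → Fin N → Carrier
  weightₑ d e k = signR R d (powR R (x k) (suc d) * powR R (p₁ - x k) e)

  -- For a valid mark (w , d) we write w = 1 + d + e, so that no truncated subtraction remains.
  weight≡weightₑ : ∀ d e k → weight (suc d ℕ.+ e , d) k ≡ weightₑ d e k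
  weight≡weightₑ d e k = cong (λ a → weightₑ d a k) (ℕP.m+n∸m≡n (suc d) e)

  weightₑ-* : ∀ d d′ e e′ k → weightₑ d e k * weightₑ d′ e′ k ≈ - weightₑ (suc (d ℕ.+ d′)) (e ℕ.+ e′) k
  weightₑ-* d d′ e e′ k = begin
    signR R d (Xₖ ^ suc d * Yₖ ^ e) * signR R d′ (Xₖ ^ suc d′ * Yₖ ^ e′)
      ≈⟨ sym (signR-+ d d′ _ _) ⟩
    signR R (d ℕ.+ d′) ((Xₖ ^ suc d * Yₖ ^ e) * (Xₖ ^ suc d′ * Yₖ ^ e′))
      ≈⟨ signR-cong (d ℕ.+ d′) (interchange _ _ _ _) ⟩
    signR R (d ℕ.+ d′) ((Xₖ ^ suc d * Xₖ ^ suc d′) * (Yₖ ^ e * Yₖ ^ e′))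
      ≈⟨ signR-cong (d ℕ.+ d′) (*-cong (sym (powR-+ Xₖ (suc d) (suc d′))) (sym (powR-+ Yₖ e e′))) ⟩
    signR R (d ℕ.+ d′) (Xₖ ^ suc (d ℕ.+ suc d′) * Yₖ ^ (e ℕ.+ e′))
      ≡⟨ cong (λ a → signR R (d ℕ.+ d′) (Xₖ ^ suc a * Yₖ ^ (e ℕ.+ e′))) (ℕP.+-suc d d′) ⟩
    signR R (d ℕ.+ d′) Z
      ≈⟨ sym (-‿involutive _) ⟩
    - (- signR R (d ℕ.+ d′) Z)
      ≈⟨ -‿cong (sym (signR-suc (d ℕ.+ d′) Z)) ⟩
    - signR R (suc (d ℕ.+ d′)) Z ∎
    where
    open import Algebra.Solver.Ring.NaturalCoefficients.Default commutativeSemiring using (solve; _:*_; _:=_)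
    Xₖ : Carrier
    Xₖ = x k
    Yₖ : Carrier
    Yₖ = p₁ - x k
    _^_ : Carrier → ℕ → Carrier
    _^_ = powR R
    Z : Carrier
    Z = Xₖ ^ suc (suc (d ℕ.+ d′)) * Yₖ ^ (e ℕ.+ e′)
    interchange : ∀ p q r s → (p * q) * (r * s) ≈ (p * r) * (q * s)
    interchange = solve 4 (λ p q r s → (p :* q) :* (r :* s) := (p :* r) :* (q :* s)) ≈-refl

  -- The extra 1 in the second component of ∔ is what produces the sign.
  weight-∔ : ∀ m m′ → Valid m → Valid m′ → ∀ k → weight m k * weight m′ k ≈ - weight (m ∔ m′) k
  weight-∔ (w , d) (w′ , d′) d<w d′<w′ k
    with e , refl ← ℕP.m≤n⇒∃[o]m+o≡n d<w | e′ , refl ← ℕP.m≤n⇒∃[o]m+o≡n d′<w′ = begin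
    weight (suc d ℕ.+ e , d) k * weight (suc d′ ℕ.+ e′ , d′) k
      ≡⟨ cong₂ _*_ (weight≡weightₑ d e k) (weight≡weightₑ d′ e′ k) ⟩
    weightₑ d e k * weightₑ d′ e′ k
      ≈⟨ weightₑ-* d d′ e e′ k ⟩
    - weightₑ (suc (d ℕ.+ d′)) (e ℕ.+ e′) k
      ≡⟨ cong -_ (≡.sym (≡.trans (cong (λ m → weight m k) merged) (weight≡weightₑ (suc (d ℕ.+ d′)) (e ℕ.+ e′) k))) ⟩
    - weight ((suc d ℕ.+ e , d) ∔ (suc d′ ℕ.+ e′ , d′)) k ∎
    where
    merged : (suc d ℕ.+ e , d) ∔ (suc d′ ℕ.+ e′ , d′) ≡ (suc (suc (d ℕ.+ d′)) ℕ.+ (e ℕ.+ e′) , suc (d ℕ.+ d′))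
    merged = cong₂ _,_ (sum-w d d′ e e′) (sum-d d d′)
      where
      sum-w : ∀ d d′ e e′ → suc d ℕ.+ e ℕ.+ (suc d′ ℕ.+ e′) ≡ suc (suc (d ℕ.+ d′)) ℕ.+ (e ℕ.+ e′)
      sum-w = solve-∀
      sum-d : ∀ d d′ → d ℕ.+ d′ ℕ.+ 1 ≡ suc (d ℕ.+ d′)
      sum-d = solve-∀

  weight-suc : ∀ w d → Valid (w , d) → ∀ k → weight (suc w , d) k ≈ weight (w , d) k * (p₁ - x k)
  weight-suc w d d<w k = begin
    weightₑ d (suc w ℕ.∸ suc d) k  ≡⟨ cong (λ a → weightₑ d a k) (ℕP.+-∸-assoc 1 d<w) ⟩
    signR R d (A * (Y * B))        ≈⟨ signR-cong d (trans (*-congˡ (*-comm Y B)) (sym (*-assoc A B Y))) ⟩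
    signR R d ((A * B) * Y)        ≈⟨ signR-*ʳ d _ _ ⟩
    weightₑ d (w ℕ.∸ suc d) k * Y  ∎
    where
    Y : Carrier
    Y = p₁ - x k
    A : Carrier
    A = powR R (x k) (suc d)
    B : Carrier
    B = powR R Y (w ℕ.∸ suc d)

  module _ (vs : List (ℕ × Mark)) (u v : ℕ) (φ : Assignment → Carrier) (d : Distinct vs)
           (u∈ : occurs u vs ≡ true) (v∈ : occurs v vs ≡ true) (u≢v : (u ≡ᵇ v) ≡ false)
           (φ-cong : Congruent φ) (ρ : Assignment) where

    private
      v≢u : (v ≡ᵇ u) ≡ false
      v≢u = ≡.trans (≡ᵇ-sym v u) u≢v

      merged : Assignment → Fin N → Carrier
      merged ρ k = φ (ρ [ v ≔ toℕ k ] [ u ≔ toℕ k ])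

      S : Fin N → Carrier
      S k = stateSum (removeV v (removeV u vs)) (λ ρ → merged ρ k) ρ

    stateSum-δ : stateSum vs (λ ρ → δ (ρ u) (ρ v) * φ ρ) ρ
                 ≈ Σᶜ (λ k → (weight (markOf u vs) k * weight (markOf v vs) k) * S k)
    stateSum-δ = begin
      stateSum vs (λ ρ → δ (ρ u) (ρ v) * φ ρ) ρ
        ≈⟨ stateSum-extract vs u _ d u∈ (λ ρ≗ρ′ → *-cong (reflexive (cong₂ δ (ρ≗ρ′ u) (ρ≗ρ′ v))) (φ-cong ρ≗ρ′)) ρ ⟩
      Σᶜ (λ k → weight (markOf u vs) k * stateSum Lᵤ (λ ρ → δ ((ρ [ u ≔ toℕ k ]) u) ((ρ [ u ≔ toℕ k ]) v) * φ (ρ [ u ≔ toℕ k ])) ρ)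
        ≈⟨ Σᶜ-cong (λ k → *-congˡ (stateSum-cong Lᵤ (λ ρ′ → *-congʳ (reflexive (≡.trans
             (cong₂ δ (update-same ρ′ u (toℕ k)) (update-other ρ′ (toℕ k) v v≢u)) (δ-sym (toℕ k) (ρ′ v))))) ρ)) ⟩
      Σᶜ (λ k → weight (markOf u vs) k * stateSum Lᵤ (λ ρ → δ (ρ v) (toℕ k) * φ (ρ [ u ≔ toℕ k ])) ρ)
        ≈⟨ Σᶜ-cong (λ k → *-congˡ (stateSum-pin Lᵤ v k _ (Distinct-removeV u d) (≡.trans (occurs-removeV vs v≢u) v∈)
             (λ ρ≗ρ′ → φ-cong (update-cong u ρ≗ρ′ refl)) ρ)) ⟩
      Σᶜ (λ k → weight (markOf u vs) k * (weight (markOf v Lᵤ) k * S k))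
        ≈⟨ Σᶜ-cong (λ k → trans (*-congˡ (*-congʳ (reflexive (cong (λ m → weight m k) (markOf-removeV vs v≢u)))))
                                (sym (*-assoc _ _ _))) ⟩
      Σᶜ (λ k → (weight (markOf u vs) k * weight (markOf v vs) k) * S k) ∎
      where
      Lᵤ : List (ℕ × Mark)
      Lᵤ = removeV u vs

    stateSum-contractVerts : stateSum (contractVerts u v vs) (λ ρ → φ (ρ [ v ≔ ρ u ])) ρ
                             ≈ Σᶜ (λ k → weight (markOf u vs ∔ markOf v vs) k * S k)
    stateSum-contractVerts = begin
      stateSum cv ψ ρ
        ≈⟨ stateSum-extract cv u ψ (Distinct-setMark u Mᵤᵥ (Distinct-removeV v d)) u∈cv
             (λ ρ≗ρ′ → φ-cong (update-cong v ρ≗ρ′ (ρ≗ρ′ u))) ρ ⟩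
      Σᶜ (λ k → weight (markOf u cv) k * stateSum (removeV u cv) (λ ρ → ψ (ρ [ u ≔ toℕ k ])) ρ)
        ≈⟨ Σᶜ-cong (λ k → *-cong (reflexive (cong (λ m → weight m k) (markOf-setMark u Mᵤᵥ (removeV v vs) u∈ᵥ)))
             (trans (reflexive (cong (λ L → stateSum L _ ρ) (≡.trans (removeV-setMark u Mᵤᵥ (removeV v vs)) (removeV-comm u v vs))))
                    (stateSum-cong (removeV v (removeV u vs)) (λ ρ′ → φ-cong (λ a → ≡.trans
                      (cong (λ t → (ρ′ [ u ≔ toℕ k ] [ v ≔ t ]) a) (update-same ρ′ u (toℕ k))) (update-comm ρ′ (toℕ k) (toℕ k) u≢v a))) ρ))) ⟩
      Σᶜ (λ k → weight Mᵤᵥ k * S k) ∎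
      where
      Mᵤᵥ : Mark
      Mᵤᵥ = markOf u vs ∔ markOf v vs
      cv : List (ℕ × Mark)
      cv = contractVerts u v vs
      ψ : Assignment → Carrier
      ψ ρ = φ (ρ [ v ≔ ρ u ])
      u∈ᵥ : occurs u (removeV v vs) ≡ true
      u∈ᵥ = ≡.trans (occurs-removeV vs u≢v) u∈
      u∈cv : occurs u cv ≡ true
      u∈cv = ≡.trans (occurs-setMark u u Mᵤᵥ (removeV v vs)) u∈ᵥ

    stateSum-contract : Valid (markOf u vs) → Valid (markOf v vs) →
      stateSum vs (λ ρ → δ (ρ u) (ρ v) * φ ρ) ρ ≈ - stateSum (contractVerts u v vs) (λ ρ → φ (ρ [ v ≔ ρ u ])) ρ
    stateSum-contract u-valid v-valid = begin
      stateSum vs (λ ρ → δ (ρ u) (ρ v) * φ ρ) ρ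
        ≈⟨ stateSum-δ ⟩
      Σᶜ (λ k → (weight (markOf u vs) k * weight (markOf v vs) k) * S k)
        ≈⟨ Σᶜ-cong (λ k → trans (*-congʳ (weight-∔ _ _ u-valid v-valid k)) (sym (-‿distribˡ-* _ _))) ⟩
      Σᶜ (λ k → - (weight (markOf u vs ∔ markOf v vs) k * S k))
        ≈⟨ ∑-neg (allFin N) _ ⟩
      - Σᶜ (λ k → weight (markOf u vs ∔ markOf v vs) k * S k)
        ≈⟨ -‿cong (sym stateSum-contractVerts) ⟩
      - stateSum (contractVerts u v vs) (λ ρ → φ (ρ [ v ≔ ρ u ])) ρ ∎

  proper : List Edge → Assignment → Carrier
  proper []             ρ = 1#
  proper ((a , b) ∷ es) ρ = δᶜ (ρ a) (ρ b) * proper es ρ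

  proper-congruent : ∀ es → Congruent (proper es)
  proper-congruent []             ρ≗ρ′ = ≈-refl
  proper-congruent ((a , b) ∷ es) ρ≗ρ′ = *-cong (reflexive (cong₂ δᶜ (ρ≗ρ′ a) (ρ≗ρ′ b))) (proper-congruent es ρ≗ρ′)

  proper-renameE : ∀ v u es ρ → proper (renameE v u es) ρ ≡ proper es (ρ [ v ≔ ρ u ])
  proper-renameE v u []             ρ = refl
  proper-renameE v u ((a , b) ∷ es) ρ =
    cong₂ _*_ (cong₂ δᶜ (BP.if-float ρ (a ≡ᵇ v)) (BP.if-float ρ (b ≡ᵇ v))) (proper-renameE v u es ρ)

  module _ (z : Mark → Carrier) (z-weight : ∀ m → Valid m → z m ≈ Σᶜ (weight m)) where

    M-edgeless : ∀ vs → All (Valid ∘ proj₂) vs → ∀ ρ →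
                 prodR R (map (λ p → z (proj₂ p)) vs) ≈ stateSum vs (λ _ → 1#) ρ
    M-edgeless vs ok ρ = trans (factors vs ok) (sym (stateSum-one vs ρ))
      where
      factors : ∀ vs → All (Valid ∘ proj₂) vs →
                prodR R (map (λ p → z (proj₂ p)) vs) ≈ prodR R (map (λ p → Σᶜ (weight (proj₂ p))) vs)
      factors []             []             = ≈-refl
      factors ((v , m) ∷ vs) (m-valid ∷ ok) = *-cong (z-weight m m-valid) (factors vs ok)

    -- Deletion–contraction for the state sum: δᶜ = 1 − δ, and the δ-term is a contraction.
    proper-deleteContract : ∀ vs u v es → WellFormed vs ((u , v) ∷ es) → (u ≡ᵇ v) ≡ false → ∀ ρ →
      stateSum vs (proper ((u , v) ∷ es)) ρ
        ≈ stateSum vs (proper es) ρ + stateSum (contractVerts u v vs) (proper (renameE v u es)) ρ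
    proper-deleteContract vs u v es wf u≢v ρ with (u∈ , v∈) ∷ _ ← endpoints wf = begin
      stateSum vs (λ ρ → δᶜ (ρ u) (ρ v) * proper es ρ) ρ
        ≈⟨ stateSum-cong vs (λ ρ → δᶜ-*≈-δ-* (ρ u) (ρ v) (proper es ρ)) ρ ⟩
      stateSum vs (λ ρ → proper es ρ + - (δ (ρ u) (ρ v) * proper es ρ)) ρ
        ≈⟨ trans (stateSum-+ vs _ _ ρ) (+-congˡ (stateSum-neg vs _ ρ)) ⟩
      stateSum vs (proper es) ρ + - stateSum vs (λ ρ → δ (ρ u) (ρ v) * proper es ρ) ρ
        ≈⟨ +-congˡ (-‿cong (stateSum-contract vs u v (proper es) (distinct wf) u∈ v∈ u≢v (proper-congruent es) ρ
             (markOf-valid u (valid wf)) (markOf-valid v (valid wf)))) ⟩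
      stateSum vs (proper es) ρ + - (- stateSum cv (λ ρ → proper es (ρ [ v ≔ ρ u ])) ρ)
        ≈⟨ +-congˡ (-‿involutive _) ⟩
      stateSum vs (proper es) ρ + stateSum cv (λ ρ → proper es (ρ [ v ≔ ρ u ])) ρ
        ≈⟨ +-congˡ (stateSum-cong cv (λ ρ → reflexive (≡.sym (proper-renameE v u es ρ))) ρ) ⟩
      stateSum vs (proper es) ρ + stateSum cv (proper (renameE v u es)) ρ ∎
      where
      cv = contractVerts u v vs

    M-stateSum : ∀ f vs es → length es ≡ f → WellFormed vs es → ∀ ρ →
                 Mfuel R f 0# z vs es ≈ stateSum vs (proper es) ρ
    M-stateSum zero    vs []             _   wf ρ = M-edgeless vs (valid wf) ρ
    M-stateSum (suc f) vs ((u , v) ∷ es) len wf ρ with u ≡ᵇ v in u≡v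
    ... | true  = trans (zeroˡ _) (sym (stateSum-zero vs (λ ρ → trans (*-congʳ (reflexive
                    (≡.trans (cong (λ t → δᶜ (ρ u) (ρ t)) (≡.sym (≡ᵇ-true⇒≡ u v u≡v))) (δᶜ-refl (ρ u))))) (zeroˡ _)) ρ))
    ... | false = trans
      (+-cong (M-stateSum f vs es len′ wf′ ρ)
              (M-stateSum f (contractVerts u v vs) (renameE v u es) (≡.trans (LP.length-map _ es) len′)
                          (WellFormed-contract wf u≡v) ρ))
      (sym (proper-deleteContract vs u v es wf u≡v ρ))
      where
      len′ : length es ≡ f
      len′ = ℕP.suc-injective len
      wf′ : WellFormed vs es
      wf′ = record { distinct = distinct wf ; valid = valid wf ; endpoints = All.tail (endpoints wf) }

  Σᶜ≠ : ℕ → Carrier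
  Σᶜ≠ n = Σᶜ (λ k → δᶜ n (toℕ k) * x k)

  Σᶜ≠-toℕ : ∀ c → Σᶜ≠ (toℕ c) ≈ p₁ - x c
  Σᶜ≠-toℕ c = begin
    Σᶜ (λ k → δᶜ (toℕ c) (toℕ k) * x k)            ≈⟨ Σᶜ-cong (λ k → δᶜ-*≈-δ-* (toℕ c) (toℕ k) (x k)) ⟩
    Σᶜ (λ k → x k + - (δ (toℕ c) (toℕ k) * x k))   ≈⟨ trans (∑-+ (allFin N) _ _) (+-congˡ (∑-neg (allFin N) _)) ⟩
    p₁ - Σᶜ (λ k → δ (toℕ c) (toℕ k) * x k)        ≈⟨ +-congˡ (-‿cong (trans (Σᶜ-cong (λ k → *-congʳ (reflexive (δ-sym (toℕ c) (toℕ k)))))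
                                                                         (∑-δ N c x))) ⟩
    p₁ - x c                                        ∎

  -- The colour of the leaf v ranges over all colours but that of u.
  stateSum-sumOutLeaf : ∀ vs u v Q → Distinct vs → occurs v vs ≡ true → (u ≡ᵇ v) ≡ false →
    markOf v vs ≡ (1 , 0) → Congruent Q → (∀ ρ k → Q (ρ [ v ≔ k ]) ≈ Q ρ) → ∀ ρ →
    stateSum vs (λ ρ → δᶜ (ρ u) (ρ v) * Q ρ) ρ ≈ stateSum (removeV v vs) (λ ρ → Σᶜ≠ (ρ u) * Q ρ) ρ
  stateSum-sumOutLeaf vs u v Q d v∈ u≢v v-leaf Q-cong Q-free ρ = begin
    stateSum vs (λ ρ → δᶜ (ρ u) (ρ v) * Q ρ) ρ
      ≈⟨ stateSum-extract vs v _ d v∈ (λ ρ≗ρ′ → *-cong (reflexive (cong₂ δᶜ (ρ≗ρ′ u) (ρ≗ρ′ v))) (Q-cong ρ≗ρ′)) ρ ⟩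
    Σᶜ (λ k → weight (markOf v vs) k * stateSum L (λ ρ → δᶜ ((ρ [ v ≔ toℕ k ]) u) ((ρ [ v ≔ toℕ k ]) v) * Q (ρ [ v ≔ toℕ k ])) ρ)
      ≈⟨ Σᶜ-cong (λ k → *-cong (trans (reflexive (cong (λ m → weight m k) v-leaf)) (weight-𝟙 k))
           (stateSum-cong L (λ ρ′ → *-cong (reflexive (cong₂ δᶜ (update-other ρ′ (toℕ k) u u≢v) (update-same ρ′ v (toℕ k))))
                                           (Q-free ρ′ (toℕ k))) ρ)) ⟩
    Σᶜ (λ k → x k * stateSum L (λ ρ → δᶜ (ρ u) (toℕ k) * Q ρ) ρ)
      ≈⟨ Σᶜ-cong (λ k → sym (stateSum-*ˡ L _ _ ρ)) ⟩
    Σᶜ (λ k → stateSum L (λ ρ → x k * (δᶜ (ρ u) (toℕ k) * Q ρ)) ρ)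
      ≈⟨ sym (stateSum-Σᶜ L _ ρ) ⟩
    stateSum L (λ ρ → Σᶜ (λ k → x k * (δᶜ (ρ u) (toℕ k) * Q ρ))) ρ
      ≈⟨ stateSum-cong L (λ ρ′ → trans (Σᶜ-cong (λ k → trans (sym (*-assoc _ _ _)) (*-congʳ (*-comm _ _))))
                                       (∑-*ʳ (allFin N) _ _)) ρ ⟩
    stateSum L (λ ρ → Σᶜ≠ (ρ u) * Q ρ) ρ ∎
    where
    L : List (ℕ × Mark)
    L = removeV v vs

  -- The factor Σᶜ≠ (ρ u) = p₁ − x_{ρ u} is absorbed into the weight of u.
  stateSum-grow : ∀ L u Q → Distinct L → occurs u L ≡ true → Valid (markOf u L) → Congruent Q → ∀ ρ →
    stateSum L (λ ρ → Σᶜ≠ (ρ u) * Q ρ) ρ ≈ stateSum (setMark u (grow (markOf u L)) L) Q ρ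
  stateSum-grow L u Q d u∈ u-valid Q-cong ρ = begin
    stateSum L (λ ρ → Σᶜ≠ (ρ u) * Q ρ) ρ
      ≈⟨ stateSum-extract L u _ d u∈ (λ ρ≗ρ′ → *-cong (reflexive (cong Σᶜ≠ (ρ≗ρ′ u))) (Q-cong ρ≗ρ′)) ρ ⟩
    Σᶜ (λ c → weight m c * stateSum L′ (λ ρ → Σᶜ≠ ((ρ [ u ≔ toℕ c ]) u) * Q (ρ [ u ≔ toℕ c ])) ρ)
      ≈⟨ Σᶜ-cong (λ c → *-congˡ (trans (stateSum-cong L′ (λ ρ′ → *-congʳ (trans
           (reflexive (cong Σᶜ≠ (update-same ρ′ u (toℕ c)))) (Σᶜ≠-toℕ c))) ρ) (stateSum-*ˡ L′ _ _ ρ))) ⟩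
    Σᶜ (λ c → weight m c * ((p₁ - x c) * S c))
      ≈⟨ Σᶜ-cong (λ c → trans (sym (*-assoc _ _ _)) (*-congʳ (sym (weight-suc (proj₁ m) (proj₂ m) u-valid c)))) ⟩
    Σᶜ (λ c → weight (grow m) c * S c)
      ≈⟨ Σᶜ-cong (λ c → sym (*-cong (reflexive (cong (λ m′ → weight m′ c) (markOf-setMark u (grow m) L u∈)))
                                     (reflexive (cong (λ L″ → stateSum L″ _ ρ) (removeV-setMark u (grow m) L))))) ⟩
    Σᶜ (λ c → weight (markOf u L↑) c * stateSum (removeV u L↑) (λ ρ → Q (ρ [ u ≔ toℕ c ])) ρ)
      ≈⟨ sym (stateSum-extract L↑ u Q (Distinct-setMark u (grow m) d) (≡.trans (occurs-setMark u u _ L) u∈) Q-cong ρ) ⟩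
    stateSum L↑ Q ρ ∎
    where
    m : Mark
    m = markOf u L
    L′ : List (ℕ × Mark)
    L′ = removeV u L
    L↑ : List (ℕ × Mark)
    L↑ = setMark u (grow m) L
    S : Fin N → Carrier
    S c = stateSum L′ (λ ρ → Q (ρ [ u ≔ toℕ c ])) ρ

  proper-free : ∀ v L → degree v L ≡ 0 → ∀ ρ k → proper L (ρ [ v ≔ k ]) ≈ proper L ρ
  proper-free v []             _   ρ k = ≈-refl
  proper-free v ((a , b) ∷ L) deg ρ k with degree-zero⁻ v a b L deg
  ... | a≢v , b≢v , deg′ =
    *-cong (reflexive (cong₂ δᶜ (update-other ρ k a a≢v) (update-other ρ k b b≢v))) (proper-free v L deg′ ρ k)

  proper-extract : ∀ A {e} B {u v} → Joins e u v → ∀ ρ → proper (A ++ e ∷ B) ρ ≈ δᶜ (ρ u) (ρ v) * proper (A ++ B) ρ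
  proper-extract []            B         (inj₁ refl) ρ = ≈-refl
  proper-extract []            B {u} {v} (inj₂ refl) ρ = *-congʳ (reflexive (δᶜ-sym (ρ v) (ρ u)))
  proper-extract ((a , b) ∷ A) B joins ρ = trans (*-congˡ (proper-extract A B joins ρ)) (x*yz≈y*xz _ _ _)

  stateSum-absorb : ∀ {G G′} → Absorption G G′ → WellFormed (verts G) (edges G) → ∀ ρ →
    stateSum (verts G) (proper (edges G)) ρ ≈ stateSum (verts G′) (proper (edges G′)) ρ
  stateSum-absorb {G} record { root = u ; leaf = v ; edge = e ; before = A ; after = B ; edges-split = split ; joins = joins
                             ; root≢leaf = u≢v ; leaf-mark = leaf-mark ; leaf-isolated = isolated ; result = refl } wf ρ
    with u∈ , v∈ ← Joins-endpoints {vs = verts G} joins (All.head (All.++⁻ʳ A (subst (All (Endpoints (verts G))) split (endpoints wf)))) = begin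
    stateSum vs (proper (edges G)) ρ
      ≡⟨ cong (λ E → stateSum vs (proper E) ρ) split ⟩
    stateSum vs (proper (A ++ e ∷ B)) ρ
      ≈⟨ stateSum-cong vs (proper-extract A B joins) ρ ⟩
    stateSum vs (λ ρ → δᶜ (ρ u) (ρ v) * proper (A ++ B) ρ) ρ
      ≈⟨ stateSum-sumOutLeaf vs u v _ (distinct wf) v∈ u≢v leaf-mark (proper-congruent (A ++ B)) (proper-free v (A ++ B) isolated) ρ ⟩
    stateSum (removeV v vs) (λ ρ → Σᶜ≠ (ρ u) * proper (A ++ B) ρ) ρ
      ≈⟨ stateSum-grow (removeV v vs) u _ (Distinct-removeV v (distinct wf)) (≡.trans (occurs-removeV vs u≢v) u∈)
                       (markOf-valid u (valid-removeV v (valid wf))) (proper-congruent (A ++ B)) ρ ⟩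
    stateSum (setMark u (grow (markOf u (removeV v vs))) (removeV v vs)) (proper (A ++ B)) ρ
      ≡⟨ cong (λ m → stateSum (setMark u (grow m) (removeV v vs)) (proper (A ++ B)) ρ) (markOf-removeV vs u≢v) ⟩
    stateSum (setMark u (grow (markOf u vs)) (removeV v vs)) (proper (A ++ B)) ρ ∎
    where
    vs : List (ℕ × Mark)
    vs = verts G

  stateSum-coreFuel : ∀ f G → WellFormed (verts G) (edges G) → ∀ ρ →
    stateSum (verts G) (proper (edges G)) ρ ≈ stateSum (verts (coreFuel f G)) (proper (edges (coreFuel f G))) ρ
  stateSum-coreFuel zero    G wf ρ = ≈-refl
  stateSum-coreFuel (suc f) G wf ρ with absorbStep G in step
  ... | nothing = ≈-refl
  ... | just G′ = trans (stateSum-absorb absorption wf ρ) (stateSum-coreFuel f G′ (WellFormed-absorb absorption wf) ρ)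
    where
    absorption : Absorption G G′
    absorption = absorbStep-absorption G step

  proper≈edgesDistinctᵇ : ∀ es ρ → proper es ρ ≈ fromBool (edgesDistinctᵇ es ρ)
  proper≈edgesDistinctᵇ []             ρ = ≈-refl
  proper≈edgesDistinctᵇ ((a , b) ∷ es) ρ with ρ a ≡ᵇ ρ b
  ... | true  = zeroˡ _
  ... | false = trans (*-identityˡ _) (proper≈edgesDistinctᵇ es ρ)

  monomial : ∀ {n} → (Fin n → Fin N) → Carrier
  monomial {n} κ = prodR R (map (λ v → x (κ v)) (allFin n))

  monomial-cons : ∀ {n} c (κ : Fin n → Fin N) → monomial (c ◂ κ) ≡ x c * monomial κ
  monomial-cons {n} c κ = cong (x c *_) (cong (prodR R)
    (≡.trans (LP.map-tabulate fsuc (λ v → x ((c ◂ κ) v))) (≡.sym (LP.map-tabulate id (x ∘ κ)))))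

  stateSum-unmarked : ∀ n (g : Fin n → ℕ) φ ρ →
    stateSum (unmarked g) φ ρ ≈ ∑ (allColourings n N) (λ κ → monomial κ * φ (extend ρ g κ))
  stateSum-unmarked zero    g φ ρ = sym (trans (+-identityʳ _) (*-identityˡ _))
  stateSum-unmarked (suc n) g φ ρ = begin
    Σᶜ (λ c → weight (1 , 0) c * stateSum (unmarked (g ∘ fsuc)) φ (ρ [ g fzero ≔ toℕ c ]))
      ≈⟨ Σᶜ-cong (λ c → *-cong (weight-𝟙 c) (stateSum-unmarked n (g ∘ fsuc) φ _)) ⟩
    Σᶜ (λ c → x c * ∑ (allColourings n N) (λ κ → monomial κ * φ (extend (ρ [ g fzero ≔ toℕ c ]) (g ∘ fsuc) κ)))
      ≈⟨ Σᶜ-cong (λ c → trans (sym (∑-*ˡ (allColourings n N) _ _)) (∑-cong (allColourings n N) (λ κ →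
           trans (sym (*-assoc _ _ _)) (*-congʳ (reflexive (≡.sym (monomial-cons c κ))))))) ⟩
    Σᶜ (λ c → ∑ (allColourings n N) (λ κ → term (c ◂ κ)))
      ≈⟨ Σᶜ-cong (λ c → reflexive (≡.sym (∑-map (allColourings n N) (c ◂_) term))) ⟩
    Σᶜ (λ c → ∑ (map (c ◂_) (allColourings n N)) term)
      ≈⟨ sym (∑-concatMap (allFin N) (λ c → map (c ◂_) (allColourings n N)) term) ⟩
    ∑ (allColourings (suc n) N) term ∎
    where
    term : (Fin (suc n) → Fin N) → Carrier
    term κ = monomial κ * φ (extend ρ g κ)

  X-stateSum : ∀ {n} (G : SimpleGraph n) ρ → X R G x ≈ stateSum (verts (marked𝟙 G)) (proper (edgeList G)) ρ
  X-stateSum {n} G ρ = begin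
    X R G x
      ≈⟨ ∑-filter (allColourings n N) (properᵇ G) monomial ⟩
    ∑ (allColourings n N) (λ κ → monomial κ * fromBool (properᵇ G κ))
      ≈⟨ ∑-cong (allColourings n N) (λ κ → *-congˡ (sym (trans (proper≈edgesDistinctᵇ (edgeList G) _) (reflexive
           (cong fromBool (≡.sym (properᵇ≡edgesDistinctᵇ G κ (extend ρ toℕ κ) (extend-at ρ toℕ κ toℕ-Injective)))))))) ⟩
    ∑ (allColourings n N) (λ κ → monomial κ * proper (edgeList G) (extend ρ toℕ κ))
      ≈⟨ sym (stateSum-unmarked n toℕ (proper (edgeList G)) ρ) ⟩
    stateSum (unmarked (toℕ {n})) (proper (edgeList G)) ρ
      ≡⟨ cong (λ vs → stateSum vs (proper (edgeList G)) ρ) (≡.sym (verts-marked𝟙 G)) ⟩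
    stateSum (verts (marked𝟙 G)) (proper (edgeList G)) ρ ∎

  stateSum-leaves : ∀ m (h : Fin m → ℕ) u → Injective h → (∀ i → (u ≡ᵇ h i) ≡ false) → ∀ ρ →
    stateSum (unmarked h) (proper (tabulate (λ j → (u , h j)))) ρ ≈ powR R (Σᶜ≠ (ρ u)) m
  stateSum-leaves zero    h u h-inj u∉ ρ = ≈-refl
  stateSum-leaves (suc m) h u h-inj u∉ ρ = begin
    Σᶜ (λ c → weight (1 , 0) c * stateSum leaves (λ ρ′ → δᶜ (ρ′ u) (ρ′ (h fzero)) * rest ρ′) (ρ [ h fzero ≔ toℕ c ]))
      ≈⟨ Σᶜ-cong (λ c → *-cong (weight-𝟙 c) (trans
           (stateSum-local leaves _ (λ ρ′ → δᶜ (ρ u) (toℕ c) * rest ρ′) _ (λ ρ′ ρ′≈ → *-congʳ (reflexive (cong₂ δᶜ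
              (≡.trans (ρ′≈ u (occurs-unmarked-false (h ∘ fsuc) u (u∉ ∘ fsuc))) (update-other ρ (toℕ c) u (u∉ fzero)))
              (≡.trans (ρ′≈ (h fzero) (occurs-unmarked-false (h ∘ fsuc) (h fzero) (Injective-head h-inj)))
                       (update-same ρ (h fzero) (toℕ c)))))))
           (trans (stateSum-*ˡ leaves _ rest _)
                  (*-congˡ (trans (stateSum-leaves m (h ∘ fsuc) u (Injective-suc h-inj) (u∉ ∘ fsuc) _)
                    (reflexive (cong (λ a → powR R (Σᶜ≠ a) m) (update-other ρ (toℕ c) u (u∉ fzero))))))))) ⟩
    Σᶜ (λ c → x c * (δᶜ (ρ u) (toℕ c) * powR R (Σᶜ≠ (ρ u)) m))
      ≈⟨ Σᶜ-cong (λ c → trans (sym (*-assoc _ _ _)) (*-congʳ (*-comm _ _))) ⟩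
    Σᶜ (λ c → (δᶜ (ρ u) (toℕ c) * x c) * powR R (Σᶜ≠ (ρ u)) m)
      ≈⟨ ∑-*ʳ (allFin N) _ _ ⟩
    Σᶜ≠ (ρ u) * powR R (Σᶜ≠ (ρ u)) m ∎
    where
    leaves : List (ℕ × Mark)
    leaves = unmarked (h ∘ fsuc)
    rest : Assignment → Carrier
    rest = proper (tabulate (λ j → (u , h (fsuc j))))

  X-Star : ∀ k → X R (Star (suc k)) x ≈ Σᶜ (λ c → x c * powR R (p₁ - x c) k)
  X-Star k = begin
    X R (Star (suc k)) x
      ≈⟨ X-stateSum (Star (suc k)) ρ₀ ⟩
    stateSum (verts (marked𝟙 (Star (suc k)))) (proper (edgeList (Star (suc k)))) ρ₀
      ≡⟨ cong₂ (λ vs es → stateSum vs (proper es) ρ₀) (verts-marked𝟙 (Star (suc k))) (edgeList-Star {k}) ⟩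
    Σᶜ (λ c → weight (1 , 0) c * stateSum (unmarked (suc ∘ toℕ {k})) (proper (spokes k)) (ρ₀ [ 0 ≔ toℕ c ]))
      ≈⟨ Σᶜ-cong (λ c → *-cong (weight-𝟙 c) (trans
           (stateSum-leaves k (suc ∘ toℕ) 0 (λ i j → toℕ-Injective i j ∘ ℕP.suc-injective) (λ _ → refl) (ρ₀ [ 0 ≔ toℕ c ]))
           (powR-cong k (trans (reflexive (cong Σᶜ≠ (update-same ρ₀ 0 (toℕ c)))) (Σᶜ≠-toℕ c))))) ⟩
    Σᶜ (λ c → x c * powR R (p₁ - x c) k) ∎
    where
    ρ₀ : Assignment
    ρ₀ _ = 0

  p₁-x-p₁ : ∀ c → (p₁ - x c) - p₁ ≈ - x c
  p₁-x-p₁ c = begin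
    (p₁ + - x c) + - p₁ ≈⟨ +-congʳ (+-comm _ _) ⟩
    (- x c + p₁) + - p₁ ≈⟨ +-assoc _ _ _ ⟩
    - x c + (p₁ + - p₁) ≈⟨ +-congˡ (-‿inverseʳ p₁) ⟩
    - x c + 0#          ≈⟨ +-identityʳ _ ⟩
    - x c               ∎

  star : ℕ → Carrier
  star w = X R (Star w) x

  star-1 : star 1 ≈ p₁
  star-1 = trans (X-Star 0) (Σᶜ-cong (λ c → *-identityʳ (x c)))

  module _ (d e : ℕ) where
    open import Algebra.Solver.Ring.NaturalCoefficients.Default commutativeSemiring using (solve; _:*_; _:=_)

    private
      Y : Fin N → Carrier
      Y c = p₁ - x c

      exponent : ∀ i → i ℕ.< suc d → suc d ℕ.+ e ℕ.∸ i ≡ suc ((d ℕ.∸ i) ℕ.+ e)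
      exponent i (ℕ.s≤s i≤d) = ≡.trans (ℕP.+-∸-comm e (ℕP.m≤n⇒m≤1+n i≤d)) (cong (ℕ._+ e) (ℕP.+-∸-assoc 1 i≤d))

      regroup : ∀ s a X′ Yₑ Yᵢ p → s * (a * ((X′ * (Yᵢ * Yₑ)) * p)) ≈ (X′ * Yₑ) * (s * (a * (Yᵢ * p)))
      regroup = solve 6 (λ s a X′ Yₑ Yᵢ p → s :* (a :* ((X′ :* (Yᵢ :* Yₑ)) :* p)) := (X′ :* Yₑ) :* (s :* (a :* (Yᵢ :* p)))) ≈-refl

    Dbullet-term : ∀ i → i ℕ.< suc d →
      signR R i (fromℕR R (d C i) * (star (suc d ℕ.+ e ℕ.∸ i) * powR R (star 1) i))
        ≈ Σᶜ (λ c → (x c * powR R (Y c) e) * binomialTerm d (Y c) p₁ i)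
    Dbullet-term i i<d = begin
      signR R i (coeff * (star (suc d ℕ.+ e ℕ.∸ i) * powR R (star 1) i))
        ≈⟨ signR≈sign1* i _ ⟩
      s * (coeff * (star (suc d ℕ.+ e ℕ.∸ i) * powR R (star 1) i))
        ≈⟨ *-congˡ (*-congˡ (*-cong (trans (reflexive (cong star (exponent i i<d))) (X-Star _)) (powR-cong i star-1))) ⟩
      s * (coeff * (Σᶜ (λ c → x c * powR R (Y c) ((d ℕ.∸ i) ℕ.+ e)) * powR R p₁ i))
        ≈⟨ *-congˡ (trans (*-congˡ (sym (∑-*ʳ (allFin N) _ _))) (sym (∑-*ˡ (allFin N) _ _))) ⟩
      s * Σᶜ (λ c → coeff * ((x c * powR R (Y c) ((d ℕ.∸ i) ℕ.+ e)) * powR R p₁ i))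
        ≈⟨ sym (∑-*ˡ (allFin N) _ _) ⟩
      Σᶜ (λ c → s * (coeff * ((x c * powR R (Y c) ((d ℕ.∸ i) ℕ.+ e)) * powR R p₁ i)))
        ≈⟨ Σᶜ-cong (λ c → trans (*-congˡ (*-congˡ (*-congʳ (*-congˡ (powR-+ (Y c) (d ℕ.∸ i) e)))))
                                (trans (regroup _ _ _ _ _ _) (*-congˡ (sym (signR≈sign1* i _))))) ⟩
      Σᶜ (λ c → (x c * powR R (Y c) e) * binomialTerm d (Y c) p₁ i) ∎
      where
      s : Carrier
      s = signR R i 1#
      coeff : Carrier
      coeff = fromℕR R (d C i)

    Dbullet-Star-excess : Dbullet R star (suc d ℕ.+ e , d) ≈ Σᶜ (weight (suc d ℕ.+ e , d))
    Dbullet-Star-excess = begin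
      Dbullet R star (suc d ℕ.+ e , d)
        ≈⟨ ∑-upTo-cong (suc d) Dbullet-term ⟩
      ∑ (upTo (suc d)) (λ i → Σᶜ (λ c → (x c * powR R (Y c) e) * binomialTerm d (Y c) p₁ i))
        ≈⟨ ∑-swap (upTo (suc d)) (allFin N) _ ⟩
      Σᶜ (λ c → ∑ (upTo (suc d)) (λ i → (x c * powR R (Y c) e) * binomialTerm d (Y c) p₁ i))
        ≈⟨ Σᶜ-cong (λ c → trans (∑-*ˡ (upTo (suc d)) _ _) (*-congˡ (binomial-difference d (Y c) p₁))) ⟩
      Σᶜ (λ c → (x c * powR R (Y c) e) * powR R (Y c - p₁) d)
        ≈⟨ Σᶜ-cong (λ c → *-congˡ (trans (powR-cong d (p₁-x-p₁ c)) (powR-neg (x c) d))) ⟩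
      Σᶜ (λ c → (x c * powR R (Y c) e) * signR R d (powR R (x c) d))
        ≈⟨ Σᶜ-cong (λ c → trans (*-comm _ _) (trans (sym (signR-*ʳ d _ _)) (signR-cong d (reassoc _ _ _)))) ⟩
      Σᶜ (weightₑ d e)
        ≈⟨ Σᶜ-cong (λ c → reflexive (≡.sym (weight≡weightₑ d e c))) ⟩
      Σᶜ (weight (suc d ℕ.+ e , d)) ∎
      where
      reassoc : ∀ Xᵈ X′ Yₑ → Xᵈ * (X′ * Yₑ) ≈ (X′ * Xᵈ) * Yₑ
      reassoc = solve 3 (λ Xᵈ X′ Yₑ → Xᵈ :* (X′ :* Yₑ) := (X′ :* Xᵈ) :* Yₑ) ≈-refl

  Dbullet-Star : ∀ m → Valid m → Dbullet R star m ≈ Σᶜ (weight m)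
  Dbullet-Star (w , d) d<w with e , refl ← ℕP.m≤n⇒∃[o]m+o≡n d<w = Dbullet-Star-excess d e

theorem5p14 : ∀ {c ℓ : Level} (R : CommutativeRing c ℓ) (n : ℕ) (G : SimpleGraph n)
                (N : ℕ) (x : Fin N → CommutativeRing.Carrier R) →
                CommutativeRing._≈_ R
                  (X R G x)
                  (D R (CommutativeRing.0# R) (λ w → X R (Star w) x) (core (marked𝟙 G)))
theorem5p14 R n G N x = begin
  X R G x                                          ≈⟨ X-stateSum G ρ₀ ⟩
  stateSum (verts G𝟙) (proper (edges G𝟙)) ρ₀       ≈⟨ stateSum-coreFuel (length (edges G𝟙)) G𝟙 (WellFormed-marked𝟙 G) ρ₀ ⟩
  stateSum (verts K) (proper (edges K)) ρ₀         ≈⟨ sym (M-stateSum (Dbullet R star) Dbullet-Star (length (edges K))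
                                                                      (verts K) (edges K) refl K-wellFormed ρ₀) ⟩
  D R 0# star K                                    ∎
  where
  open CommutativeRing R using (sym; setoid; 0#)
  open import Relation.Binary.Reasoning.Setoid setoid
  open ColourSums R N x
  G𝟙 : MGraph
  G𝟙 = marked𝟙 G
  K : MGraph
  K = core G𝟙
  K-wellFormed : WellFormed (verts K) (edges K)
  K-wellFormed = WellFormed-coreFuel (length (edges G𝟙)) G𝟙 (WellFormed-marked𝟙 G)
  ρ₀ : Assignment
  ρ₀ _ = 0
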